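{- Let $G$ be a graph on $n \geq 3$ vertices with $s = |E(G)| \geq 3$ edges $e_1, \dots, e_s$, where $e_i = u_i v_i$, and suppose $G$ has finite girth $g \in \mathbb{N}$. Let $m \in \mathbb{N}$ and let $\mathcal{H}=(L,H)$ be an $m$-fold cover of $G$ such that $|E_H(L(u),L(v))| = m$ whenever $uv \in E(G)$. Let $\mathcal{U} = \{ I \subseteq V(H) : |L(v) \cap I| = 1 \text{ for each } v \in V(G)\}$, and for each $i \in [s]$ let $S_i$ be the set of all $I \in \mathcal{U}$ such that $H[I]$ contains an edge of $E_H(L(u_i),L(v_i))$. Then: (i) for any $k \in [g-1]$ and any $i_1 < \cdots < i_k$ in $[s]$, $\left|\bigcap_{j=1}^k S_{i_j}\right| = m^{n-k}$; (ii) if $e_{i_1}, \dots, e_{i_g}$ are distinct edges of $G$, then $\left|\bigcap_{j=1}^g S_{i_j}\right| \leq m^{n-g+1}$, and moreover $\left|\bigcap_{j=1}^g S_{i_j}\right| = m^{n-g}$ when $e_{i_1}, \dots, e_{i_g}$ are not the edges of a $g$-cycle in $G$; (iii) for any $k \geq g+1$ and any $i_1 < \cdots < i_k$ in $[s]$, $\left|\bigcap_{j=1}^k S_{i_j}\right| \leq m^{n-g}$.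
   Context: All graphs are finite and simple; $[m]=\{1,\dots,m\}$; the girth is the length of a shortest cycle. A cover of a graph $G$ is a pair $\mathcal{H}=(L,H)$ where $H$ is a graph and $L: V(G) \to \mathcal{P}(V(H))$ satisfies: (1) $\{L(u): u \in V(G)\}$ is a partition of $V(H)$; (2) for every $u$, $H[L(u)]$ is complete; (3) if $E_H(L(u),L(v))$ is nonempty then $u=v$ or $uv \in E(G)$; (4) if $uv \in E(G)$, then $E_H(L(u),L(v))$ is a matching. Here $E_H(S,U)$ is the set of edges of $H$ with one endpoint in $S$ and one in $U$. The cover is $m$-fold if $|L(u)|=m$ for all $u \in V(G)$. -}

module Defs where

open import Data.Nat using (ℕ; zero; suc; _≤_)
open import Data.Nat.Properties using () renaming (_≟_ to _≟ℕ_)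
open import Data.Bool using (Bool; true; false; T)
open import Data.Bool.Properties using (T?)
open import Data.Fin using (Fin; toℕ) renaming (_<_ to _<ᶠ_)
open import Data.Fin.Properties using (all?; any?) renaming (_≟_ to _≟ᶠ_)
open import Data.Fin.Subset using (Subset; _∈_)
open import Data.Fin.Subset.Properties using (_∈?_)
open import Data.List using (List; []; _∷_; map; _++_; filter; length; allFin; cartesianProduct)
open import Data.Vec using (Vec; []; _∷_)
open import Data.Product using (Σ; ∃; _×_; _,_; proj₁; proj₂)
open import Data.Product.Properties using ()
open import Data.Sum using (_⊎_)
open import Relation.Nullary using (Dec; ¬_)
open import Relation.Nullary.Decidable using (_×-dec_)
open import Relation.Unary using (Decidable)
open import Relation.Binary.PropositionalEquality using (_≡_; _≢_)
open import Function using (Injective)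

record Graph (n : ℕ) : Set where
  field
    adj    : Fin n → Fin n → Bool
    sym    : ∀ x y → adj x y ≡ adj y x
    irrefl : ∀ x → adj x x ≡ false

Adj : ∀ {n} → Graph n → Fin n → Fin n → Set
Adj G x y = T (Graph.adj G x y)

SameEdge : ∀ {n} → Fin n → Fin n → Fin n → Fin n → Set
SameEdge a b c d = (a ≡ c × b ≡ d) ⊎ (a ≡ d × b ≡ c)

record EdgeEnum {n : ℕ} (G : Graph n) (s : ℕ) : Set where
  field
    u v      : Fin s → Fin n
    isEdge   : ∀ i → Adj G (u i) (v i)
    distinct : ∀ i j → SameEdge (u i) (v i) (u j) (v j) → i ≡ j
    complete : ∀ x y → Adj G x y → ∃ λ i → SameEdge x y (u i) (v i)

CycSucc : ∀ k → Fin k → Fin k → Set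
CycSucc k j j' = (toℕ j' ≡ suc (toℕ j)) ⊎ (toℕ j' ≡ 0 × suc (toℕ j) ≡ k)

IsCycle : ∀ {n} → Graph n → (k : ℕ) → (Fin k → Fin n) → Set
IsCycle G k w = (3 ≤ k) × Injective _≡_ _≡_ w × (∀ j j' → CycSucc k j j' → Adj G (w j) (w j'))

HasGirth : ∀ {n} → Graph n → ℕ → Set
HasGirth G g = (∃ λ w → IsCycle G g w) × (∀ k w → IsCycle G k w → g ≤ k)

countFin : ∀ {N} {P : Fin N → Set} → Decidable P → ℕ
countFin {N} P? = length (filter P? (allFin N))

countFin² : ∀ {N} {P : Fin N × Fin N → Set} → Decidable P → ℕ
countFin² {N} P? = length (filter P? (cartesianProduct (allFin N) (allFin N)))

allSubsets : (N : ℕ) → List (Subset N)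
allSubsets zero    = [] ∷ []
allSubsets (suc N) = map (true ∷_) (allSubsets N) ++ map (false ∷_) (allSubsets N)

-- An m-fold cover (L,H) of G.  V(H) = Fin N; L is given by the labelling
-- lab : V(H) → V(G), i.e. L(u) = { x : lab x ≡ u }  (so the L(u) partition V(H)).
record Cover {n : ℕ} (G : Graph n) (m : ℕ) : Set where
  field
    N        : ℕ
    H        : Graph N
    lab      : Fin N → Fin n
    fold     : ∀ u → countFin (λ x → lab x ≟ᶠ u) ≡ m
    clique   : ∀ x y → lab x ≡ lab y → x ≢ y → Adj H x y
    between  : ∀ x y → Adj H x y → lab x ≢ lab y → Adj G (lab x) (lab y)
    matching : ∀ x y y' → Adj G (lab x) (lab y) → lab y ≡ lab y' →
               Adj H x y → Adj H x y' → y ≡ y'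

module _ {n m : ℕ} {G : Graph n} (C : Cover G m) where
  open Cover C

  FullEdges : Set
  FullEdges = ∀ a b → Adj G a b →
    countFin² (λ p → (lab (proj₁ p) ≟ᶠ a) ×-dec ((lab (proj₂ p) ≟ᶠ b) ×-dec T? (Graph.adj H (proj₁ p) (proj₂ p)))) ≡ m

  InU : Subset N → Set
  InU I = ∀ v → countFin (λ x → (lab x ≟ᶠ v) ×-dec (x ∈? I)) ≡ 1

  InU? : Decidable InU
  InU? I = all? (λ v → countFin (λ x → (lab x ≟ᶠ v) ×-dec (x ∈? I)) ≟ℕ 1)

  HasEdgeIn : Fin n → Fin n → Subset N → Set
  HasEdgeIn a b I = ∃ λ x → ∃ λ y → x ∈ I × y ∈ I × lab x ≡ a × lab y ≡ b × Adj H x y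

  HasEdgeIn? : ∀ a b → Decidable (HasEdgeIn a b)
  HasEdgeIn? a b I = any? λ x → any? λ y →
    (x ∈? I) ×-dec ((y ∈? I) ×-dec ((lab x ≟ᶠ a) ×-dec ((lab y ≟ᶠ b) ×-dec T? (Graph.adj H x y))))

  module _ {s : ℕ} (E : EdgeEnum G s) where
    open EdgeEnum E

    InS : Fin s → Subset N → Set
    InS i I = InU I × HasEdgeIn (u i) (v i) I

    InS? : ∀ i → Decidable (InS i)
    InS? i I = InU? I ×-dec HasEdgeIn? (u i) (v i) I

    -- | ⋂_{j=1}^k S_{i_j} |  (for k ≥ 1; counted among all subsets of V(H))
    interCount : ∀ {k} → (Fin k → Fin s) → ℕ
    interCount {k} idx =
      length (filter (λ I → all? (λ j → InS? (idx j) I)) (allSubsets N))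

StrictlyIncreasing : ∀ {k s} → (Fin k → Fin s) → Set
StrictlyIncreasing idx = ∀ a b → a <ᶠ b → idx a <ᶠ idx b

EdgesOfCycle : ∀ {n s} {G : Graph n} → EdgeEnum G s → (g : ℕ) → (Fin g → Fin s) → Set
EdgesOfCycle {G = G} E g idx = ∃ λ w → IsCycle G g w ×
  (∀ j → ∃ λ j₁ → ∃ λ j₂ → CycSucc g j₁ j₂ × SameEdge (u (idx j)) (v (idx j)) (w j₁) (w j₂)) ×
  (∀ j₁ j₂ → CycSucc g j₁ j₂ → ∃ λ j → SameEdge (u (idx j)) (v (idx j)) (w j₁) (w j₂))
  where open EdgeEnum E

-- A transversal I of the cover (one vertex in every fibre L(v)) contains an edge of E_H(L(a),L(b))
-- exactly when its L(b)-vertex is the H-neighbour of its L(a)-vertex, since E_H(L(a),L(b)) is a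
-- perfect matching. Hence, for edges that can be removed leaf by leaf, each edge fixes the vertex of
-- I at its leaf and divides the number of transversals by m: the transversals containing k given
-- edges of a forest number m^(n-k). Fewer than g edges always form a forest, and g edges do unless
-- they are the edges of a g-cycle, when g - 1 of them still do. More than g edges contain a g-cycle
-- or a forest of g edges; in the first case another edge leaves the cycle (a shortest cycle has no
-- chords), and together with all but one cycle edge it forms a forest of g edges. The bounds follow
-- since the intersection of the S_i shrinks as edges are added.

module Submission where

open import Defs
open import Data.Nat using (ℕ; suc; _≤_; _∸_; _^_; _+_)
open import Data.Fin using (Fin)
open import Data.Product using (_×_; _,_)
open import Relation.Nullary using (¬_)
open import Relation.Binary.PropositionalEquality using (_≡_)
open import Function using (Injective)

module Counting where

  open import Data.Nat using (zero; z≤n; s≤s; _*_; _<_)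
  open import Data.Nat.Properties using (≤-antisym; +-suc)
  open import Data.Bool using (true; false)
  open import Data.Fin.Subset using (Subset) renaming (_∈_ to _∈ₛ_)
  open import Data.List using (List; []; _∷_; length; filter; map; _++_; cartesianProduct)
  open import Data.List.Properties using (length-++; length-map; length-removeAt′)
  open import Data.List.Membership.Propositional using (_∈_; _∉_)
  open import Data.List.Membership.Propositional.Properties
    using (∈-filter⁺; ∈-filter⁻; ∈-map⁺; ∈-map⁻; ∈-++⁺ˡ; ∈-++⁺ʳ)
  open import Data.List.Relation.Unary.Any using (here; there; index; _─_)
  open import Data.List.Relation.Unary.All as All using ([])
  open import Data.List.Relation.Unary.AllPairs using ([]; _∷_)
  open import Data.List.Relation.Unary.Unique.Propositional using (Unique)
  open import Data.List.Relation.Unary.Unique.Propositional.Properties using (filter⁺; map⁺; ++⁺)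
  open import Data.Vec using ([]; _∷_; tabulate)
  open import Data.Vec.Properties using (∷-injective; lookup∘tabulate; []=⇒lookup; lookup⇒[]=)
  open import Data.Product using (∃; ∃₂; _,_; proj₂)
  open import Relation.Binary.PropositionalEquality
    using (refl; sym; trans; cong; cong₂; subst; _≢_; module ≡-Reasoning)
  open import Relation.Nullary using (yes; no; does; contradiction)
  open import Relation.Nullary.Decidable using (dec-true)
  open import Relation.Unary using (Pred; Decidable; _⊆_)
  open import Relation.Unary.Properties using (∁?)

  ∈-─⁺ : ∀ {a} {A : Set a} {x y : A} {xs} (p : x ∈ xs) → y ∈ xs → y ≢ x → y ∈ (xs ─ p)
  ∈-─⁺ (here refl) (here refl) y≢x = contradiction refl y≢x
  ∈-─⁺ (here refl) (there q)   _   = q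
  ∈-─⁺ (there p)   (here refl) _   = here refl
  ∈-─⁺ (there p)   (there q)   y≢x = there (∈-─⁺ p q y≢x)

  module _ {a b} {A : Set a} {B : Set b} where

    injection⇒length≤ : ∀ {xs : List A} {ys : List B} → Unique xs →
      (f : ∀ {x} → x ∈ xs → B) →
      (∀ {x y} (p : x ∈ xs) (q : y ∈ xs) → f p ≡ f q → x ≡ y) →
      (∀ {x} (p : x ∈ xs) → f p ∈ ys) →
      length xs ≤ length ys
    injection⇒length≤ {[]}     _            _ _     _    = z≤n
    injection⇒length≤ {x ∷ xs} {ys} (x∉xs ∷ xs-unique) f f-inj f∈ys =
      subst (suc (length xs) ≤_) (sym (length-removeAt′ ys (index fx∈ys)))
        (s≤s (injection⇒length≤ xs-unique (λ p → f (there p))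
          (λ p q → f-inj (there p) (there q)) f∈ys─fx))
      where
      fx∈ys = f∈ys (here refl)
      f∈ys─fx : ∀ {y} (p : y ∈ xs) → f (there p) ∈ (ys ─ fx∈ys)
      f∈ys─fx p = ∈-─⁺ fx∈ys (f∈ys (there p))
        (λ fy≡fx → All.lookup x∉xs p (f-inj (here refl) (there p) (sym fy≡fx)))

    length-cartesianProduct : ∀ (xs : List A) (ys : List B) →
      length (cartesianProduct xs ys) ≡ length xs * length ys
    length-cartesianProduct []       ys = refl
    length-cartesianProduct (x ∷ xs) ys = begin
      length (map (x ,_) ys ++ cartesianProduct xs ys)     ≡⟨ length-++ (map (x ,_) ys) ⟩
      length (map (x ,_) ys) + length (cartesianProduct xs ys)
        ≡⟨ cong₂ _+_ (length-map (x ,_) ys) (length-cartesianProduct xs ys) ⟩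
      length ys + length xs * length ys                  ∎
      where open ≡-Reasoning

  filter-length-mono : ∀ {a p q} {A : Set a} {P : Pred A p} {Q : Pred A q} →
                       (P? : Decidable P) (Q? : Decidable Q) → ∀ {xs} → Unique xs → P ⊆ Q →
                       length (filter P? xs) ≤ length (filter Q? xs)
  filter-length-mono P? Q? {xs} xs-unique P⊆Q =
    injection⇒length≤ {xs = filter P? xs} {ys = filter Q? xs} (filter⁺ P? xs-unique)
    (λ {x} _ → x) (λ _ _ x≡y → x≡y)
    (λ x∈ → let (x∈xs , Px) = ∈-filter⁻ P? {xs = xs} x∈ in ∈-filter⁺ Q? x∈xs (P⊆Q Px))

  filter-length-cong : ∀ {a p q} {A : Set a} {P : Pred A p} {Q : Pred A q} →
                       (P? : Decidable P) (Q? : Decidable Q) → ∀ {xs} → Unique xs → P ⊆ Q → Q ⊆ P →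
                       length (filter P? xs) ≡ length (filter Q? xs)
  filter-length-cong P? Q? xs-unique P⊆Q Q⊆P =
    ≤-antisym (filter-length-mono P? Q? xs-unique P⊆Q) (filter-length-mono Q? P? xs-unique Q⊆P)

  module _ {a p} {A : Set a} {P : Pred A p} (P? : Decidable P) where

    filter-length≡1⇒∃! : ∀ xs → length (filter P? xs) ≡ 1 →
                         ∃ λ x → P x × (∀ {y} → y ∈ xs → P y → y ≡ x)
    filter-length≡1⇒∃! xs len≡1 with filter P? xs in eq | len≡1
    ... | x ∷ [] | _ = x , proj₂ (∈-filter⁻ P? {xs = xs} (subst (x ∈_) (sym eq) (here refl))) , unique
      where
      unique : ∀ {y} → y ∈ xs → P y → y ≡ x
      unique y∈xs Py with subst (_ ∈_) eq (∈-filter⁺ P? y∈xs Py)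
      ... | here y≡x = y≡x

    ∃!⇒filter-length≡1 : ∀ {xs} → Unique xs → ∀ {x} → x ∈ xs → P x → (∀ {y} → P y → y ≡ x) →
                         length (filter P? xs) ≡ 1
    ∃!⇒filter-length≡1 {xs} xs-unique {x} x∈xs Px unique = ≤-antisym
      (injection⇒length≤ {xs = filter P? xs} {ys = x ∷ []} (filter⁺ P? xs-unique)
        (λ {y} _ → y) (λ _ _ y≡z → y≡z)
        (λ y∈ → here (unique (proj₂ (∈-filter⁻ P? {xs = xs} y∈)))))
      (injection⇒length≤ {xs = x ∷ []} {ys = filter P? xs} ([] ∷ []) (λ {y} _ → y) (λ _ _ y≡z → y≡z)
        (λ { (here refl) → ∈-filter⁺ P? x∈xs Px }))

  module _ {N p} {P : Pred (Fin N) p} (P? : Decidable P) where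

    toSubset : Subset N
    toSubset = tabulate λ x → does (P? x)

    ∈-toSubset⁺ : ∀ {x} → P x → x ∈ₛ toSubset
    ∈-toSubset⁺ {x} Px = lookup⇒[]= x toSubset
      (trans (lookup∘tabulate (λ x → does (P? x)) x) (dec-true (P? x) Px))

    ∈-toSubset⁻ : ∀ {x} → x ∈ₛ toSubset → P x
    ∈-toSubset⁻ {x} x∈ with P? x | trans (sym (lookup∘tabulate (λ x → does (P? x)) x)) ([]=⇒lookup x∈)
    ... | yes Px | _ = Px
    ... | no  _  | ()

  sublist-and-extra : ∀ {a} {A : Set a} k {xs : List A} → Unique xs → k < length xs →
    ∃₂ λ ys y → Unique ys × length ys ≡ k × y ∉ ys × y ∈ xs × (∀ {z} → z ∈ ys → z ∈ xs)
  sublist-and-extra zero    {x ∷ _}  _                 _ = [] , x , [] , refl , (λ ()) , here refl , λ ()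
  sublist-and-extra (suc k) {x ∷ xs} (x∉xs ∷ xs-unique) (s≤s k<xs) =
    let (ys , y , ys-unique , ys≡k , y∉ys , y∈xs , ys⊆xs) = sublist-and-extra k xs-unique k<xs
    in x ∷ ys , y , All.tabulate (λ z∈ys → All.lookup x∉xs (ys⊆xs z∈ys)) ∷ ys-unique , cong suc ys≡k ,
       (λ { (here refl) → All.lookup x∉xs y∈xs refl ; (there y∈ys) → y∉ys y∈ys }) ,
       there y∈xs , λ { (here refl) → here refl ; (there z∈ys) → there (ys⊆xs z∈ys) }

  filter-length-partition : ∀ {a p} {A : Set a} {P : Pred A p} (P? : Decidable P) xs →
                            length (filter P? xs) + length (filter (∁? P?) xs) ≡ length xs
  filter-length-partition P? []       = refl
  filter-length-partition P? (x ∷ xs) with P? x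
  ... | yes _ = cong suc (filter-length-partition P? xs)
  ... | no  _ = trans (+-suc _ _) (cong suc (filter-length-partition P? xs))

  ∈-allSubsets : ∀ {N} (I : Subset N) → I ∈ allSubsets N
  ∈-allSubsets []          = here refl
  ∈-allSubsets (true ∷ I)  = ∈-++⁺ˡ (∈-map⁺ (true ∷_) (∈-allSubsets I))
  ∈-allSubsets (false ∷ I) = ∈-++⁺ʳ _ (∈-map⁺ (false ∷_) (∈-allSubsets I))

  allSubsets-unique : ∀ N → Unique (allSubsets N)
  allSubsets-unique zero    = [] ∷ []
  allSubsets-unique (suc N) = ++⁺ (map⁺ ∷-tail-injective (allSubsets-unique N))
                                  (map⁺ ∷-tail-injective (allSubsets-unique N)) disjoint
    where
    ∷-tail-injective : ∀ {x} {I J : Subset N} → x ∷ I ≡ x ∷ J → I ≡ J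
    ∷-tail-injective e = proj₂ (∷-injective e)
    disjoint : ∀ {I} → ¬ (I ∈ map (true ∷_) (allSubsets N) × I ∈ map (false ∷_) (allSubsets N))
    disjoint (p , q) with ∈-map⁻ (true ∷_) p | ∈-map⁻ (false ∷_) q
    ... | _ , _ , refl | _ , _ , ()

module Minimal where

  open import Data.Nat using (zero; _<_)
  open import Data.Nat.Properties using (n<1+n; m<1+n⇒m<n∨m≡n)
  open import Data.Product using (∃; _,_)
  open import Data.Sum using (_⊎_; inj₁; inj₂; [_,_])
  open import Relation.Binary.PropositionalEquality using (refl)
  open import Relation.Nullary using (yes; no; contradiction)
  open import Relation.Unary using (Pred; Decidable)

  module _ {p} {R : Pred ℕ p} (R? : Decidable R) where

    private
      search : ∀ b → (∃ λ J → R J × ∀ {J'} → J' < J → ¬ R J') ⊎ (∀ {J} → J < b → ¬ R J)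
      search zero = inj₂ λ ()
      search (suc b) with search b
      ... | inj₁ found = inj₁ found
      ... | inj₂ none with R? b
      ...   | yes Rb  = inj₁ (b , Rb , none)
      ...   | no  ¬Rb = inj₂ λ J<1+b → [ none , (λ { refl → ¬Rb }) ] (m<1+n⇒m<n∨m≡n J<1+b)

    minimal-witness : ∀ {k} → R k → ∃ λ J → R J × (∀ {J'} → J' < J → ¬ R J')
    minimal-witness {k} Rk with search (suc k)
    ... | inj₁ found = found
    ... | inj₂ none  = contradiction Rk (none (n<1+n k))

module CyclicOrder where

  open import Data.Nat using (_<?_; s≤s; NonZero)
  open import Data.Nat.Properties using (≤-antisym; ≮⇒≥; <-irrefl; n<1+n; m<n⇒m<1+n)
  open import Data.Nat.DivMod using (_mod_; m<n⇒m%n≡m)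
  open import Data.Fin using (zero; toℕ; fromℕ<)
  open import Data.Fin.Properties using (toℕ-fromℕ<; toℕ<n; toℕ-injective)
  open import Data.Product using (_,_)
  open import Data.Sum using (_⊎_; inj₁; inj₂)
  open import Relation.Binary.PropositionalEquality using (refl; trans)
  open import Relation.Nullary using (yes; no)

  next : ∀ {L} → Fin L → Fin L
  next {suc L} t with suc (toℕ t) <? suc L
  ... | yes t+1<L = fromℕ< t+1<L
  ... | no  _     = zero

  cycSucc-next : ∀ {L} (t : Fin L) → CycSucc L t (next t)
  cycSucc-next {suc L} t with suc (toℕ t) <? suc L
  ... | yes t+1<L = inj₁ (toℕ-fromℕ< t+1<L)
  ... | no  t+1≮L = inj₂ (refl , ≤-antisym (toℕ<n t) (≮⇒≥ t+1≮L))

  cycSucc-no-return : ∀ {L} → 3 ≤ L → ∀ {a b} → CycSucc L a b → ¬ CycSucc L b a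
  cycSucc-no-return L≥3 = no-return L≥3
    where
    no-return : ∀ {L x y} → 3 ≤ L →
                (y ≡ suc x ⊎ (y ≡ 0 × suc x ≡ L)) → ¬ (x ≡ suc y ⊎ (x ≡ 0 × suc y ≡ L))
    no-return _                    (inj₁ refl)         (inj₁ x≡2+x)       =
      <-irrefl x≡2+x (m<n⇒m<1+n (n<1+n _))
    no-return (s≤s (s≤s ()))       (inj₁ refl)         (inj₂ (refl , refl))
    no-return (s≤s (s≤s ()))       (inj₂ (refl , refl)) (inj₁ refl)

  toℕ-mod : ∀ {L} .{{_ : NonZero L}} (t : Fin L) → toℕ t mod L ≡ t
  toℕ-mod {L} t = toℕ-injective (trans (toℕ-fromℕ< _) (m<n⇒m%n≡m (toℕ<n t)))

module Graphs {n : ℕ} (G : Graph n) where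

  open Counting using (injection⇒length≤)
  open Minimal using (minimal-witness)
  open CyclicOrder using (toℕ-mod)
  open import Data.Nat using (zero; _<_; z≤n; s≤s; s≤s⁻¹; NonZero; >-nonZero)
  open import Data.Nat.Properties
    using (≤-trans; <-trans; ≤-<-trans; <⇒≤; <⇒≢; <⇒≱; ≤∧≢⇒<; <-cmp; n<1+n; 1+n≢0; n≢0⇒n>0;
           suc-injective; +-comm; +-suc; +-identityʳ; +-monoʳ-<; +-monoʳ-≤; +-monoˡ-≤; +-cancelˡ-≡; m+[n∸m]≡n)
  open import Data.Nat.Properties using () renaming (_≟_ to _≟ℕ_)
  open import Data.Nat.DivMod using (_mod_; m<n⇒m%n≡m)
  open import Data.Bool using (T)
  open import Data.Fin using (toℕ; fromℕ<)
  open import Data.Fin.Properties using (_≟_; any?; pigeonhole; toℕ-injective; toℕ<n; toℕ-fromℕ<)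
  open import Data.List using (List; []; _∷_; length; map; allFin)
  open import Data.List.Properties using (length-map; length-tabulate)
  open import Data.List.Membership.Propositional.Properties using (∈-allFin)
  open import Data.List.Relation.Unary.Any using (Any; here; there)
  open import Data.List.Relation.Unary.All as All using (All; []; _∷_)
  open import Data.List.Relation.Unary.All.Properties using (All¬⇒¬Any; map⁺)
  open import Data.List.Relation.Unary.AllPairs using ([]; _∷_)
  open import Data.List.Relation.Unary.Unique.Propositional using (Unique)
  open import Data.Product using (∃; _,_; proj₁; proj₂)
  open import Data.Sum using (_⊎_; inj₁; inj₂; [_,_]; swap)
  open import Function using (id; _∘_)
  open import Relation.Binary.Definitions using (tri<; tri≈; tri>)
  open import Relation.Binary.PropositionalEquality using (refl; sym; trans; cong; subst; subst₂; _≢_)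
  open import Relation.Nullary using (yes; no; contradiction)
  open import Relation.Nullary.Decidable using (_×-dec_)
  open import Relation.Unary using (Decidable)

  adj-sym : ∀ {x y} → Adj G x y → Adj G y x
  adj-sym {x} {y} = subst T (Graph.sym G x y)

  adj-irrefl : ∀ {x y} → Adj G x y → x ≢ y
  adj-irrefl {x} xx refl = subst T (Graph.irrefl G x) xx

  Touches : Fin n → Fin n × Fin n → Set
  Touches z q = proj₁ q ≡ z ⊎ proj₂ q ≡ z

  -- A forest listed in leaf-removal order: the leaf b of an edge (a , b) lies on no later edge.
  data Pruning : List (Fin n × Fin n) → Set where
    []    : Pruning []
    prune : ∀ {a b ps} → Adj G a b → All (¬_ ∘ Touches b) ps → Pruning ps → Pruning ((a , b) ∷ ps)

  private
    leaves-unique : ∀ {ps} → Pruning ps → Unique (map proj₂ ps)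
    leaves-unique []                  = []
    leaves-unique (prune _ avoids ps) =
      map⁺ (All.map (λ avoid b≡y → avoid (inj₂ (sym b≡y))) avoids) ∷ leaves-unique ps

    root : ∀ {ps} → Pruning ps → 1 ≤ length ps →
           ∃ λ r → Any (Touches r) ps × All (λ q → r ≢ proj₂ q) ps
    root (prune {a} ab _ []) _ = a , here (inj₁ refl) , adj-irrefl ab ∷ []
    root (prune _ avoids ps@(prune _ _ _)) _ with root ps (s≤s z≤n)
    ... | r , touched , not-leaf = r , there touched , (λ { refl → All¬⇒¬Any avoids touched }) ∷ not-leaf

  -- The leaves together with the root of the last edge are distinct vertices.
  pruning-length< : ∀ {ps} → Pruning ps → 1 ≤ length ps → length ps < n
  pruning-length< {ps} P len≥1 =
    subst₂ _≤_ (cong suc (length-map proj₂ ps)) (length-tabulate (λ x → x))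
      (injection⇒length≤ {xs = r ∷ map proj₂ ps} {ys = allFin n} (map⁺ not-leaf ∷ leaves-unique P)
        (λ {x} _ → x) (λ _ _ x≡y → x≡y) (λ {x} _ → ∈-allFin x))
    where
    r = proj₁ (root P len≥1)
    not-leaf = proj₂ (proj₂ (root P len≥1))

  CycleAlong : (Fin n → Fin n → Set) → Set
  CycleAlong R = ∃ λ L → ∃ λ (c : Fin L → Fin n) → IsCycle G L c × (∀ j j' → CycSucc L j j' → R (c j) (c j'))

  module _ {R : Fin n → Fin n → Set} (R⇒adj : ∀ {x y} → R x y → Adj G x y) where

    segment-cycle : (w : ℕ → Fin n) (L : ℕ) → 3 ≤ L →
      (∀ x y → x < L → y < L → w x ≡ w y → x ≡ y) →
      (∀ t → suc t < L → R (w t) (w (suc t))) → (∀ t → suc t ≡ L → R (w t) (w 0)) →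
      CycleAlong R
    segment-cycle w L L≥3 injective steps closing =
      L , w ∘ toℕ , (L≥3 , (λ e → toℕ-injective (injective _ _ (toℕ<n _) (toℕ<n _) e)) ,
                     λ j j' jj' → R⇒adj (along j j' jj')) , along
      where
      along : ∀ j j' → CycSucc L j j' → R (w (toℕ j)) (w (toℕ j'))
      along j j' (inj₁ j'≡1+j)           rewrite j'≡1+j = steps (toℕ j) (subst (_< L) j'≡1+j (toℕ<n j'))
      along j j' (inj₂ (j'≡0 , 1+j≡L)) rewrite j'≡0   = closing (toℕ j) 1+j≡L

    private
      Repeats : (ℕ → Fin n) → ℕ → Set
      Repeats w J = ∃ λ i → i < J × w i ≡ w J

      repeats? : ∀ w → Decidable (Repeats w)
      repeats? w J with any? (λ (i : Fin J) → w (toℕ i) ≟ w J)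
      ... | yes (i , wi≡wJ) = yes (toℕ i , toℕ<n i , wi≡wJ)
      ... | no  none        = no λ (i , i<J , wi≡wJ) →
        none (fromℕ< i<J , subst (λ k → w k ≡ w J) (sym (toℕ-fromℕ< i<J)) wi≡wJ)

    -- The segment between the first repetition of a vertex and its earlier occurrence is a cycle.
    walk-cycle : (w : ℕ → Fin n) → (∀ t → R (w t) (w (suc t))) → (∀ t → w (suc (suc t)) ≢ w t) →
                 CycleAlong R
    walk-cycle w step no-backtrack with pigeonhole (n<1+n n) (λ (t : Fin (suc n)) → w (toℕ t))
    ... | i₀ , j₀ , i₀<j₀ , same with minimal-witness (repeats? w) (toℕ i₀ , i₀<j₀ , same)
    ... | J , (i , i<J , wi≡wJ) , first =
      segment-cycle (λ k → w (i + k)) (J ∸ i) (at-least-3 (J ∸ i) i+L≡J) injective steps closing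
      where
      i+L≡J : i + (J ∸ i) ≡ J
      i+L≡J = m+[n∸m]≡n (<⇒≤ i<J)

      at-least-3 : ∀ L → i + L ≡ J → 3 ≤ L
      at-least-3 0 e = contradiction (trans (sym (+-identityʳ i)) e) (<⇒≢ i<J)
      at-least-3 1 e = contradiction (trans wi≡wJ (cong w (sym (trans (+-comm 1 i) e)))) (adj-irrefl (R⇒adj (step i)))
      at-least-3 2 e = contradiction (trans (cong w (trans (+-comm 2 i) e)) (sym wi≡wJ)) (no-backtrack i)
      at-least-3 (suc (suc (suc _))) _ = s≤s (s≤s (s≤s z≤n))

      below-J : ∀ {x} → x < J ∸ i → i + x < J
      below-J x<L = subst (_ <_) i+L≡J (+-monoʳ-< i x<L)

      injective : ∀ x y → x < J ∸ i → y < J ∸ i → w (i + x) ≡ w (i + y) → x ≡ y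
      injective x y x<L y<L e with <-cmp x y
      ... | tri< x<y _ _ = contradiction (i + x , +-monoʳ-< i x<y , e) (first (below-J y<L))
      ... | tri≈ _ x≡y _ = x≡y
      ... | tri> _ _ y<x = contradiction (i + y , +-monoʳ-< i y<x , sym e) (first (below-J x<L))

      steps : ∀ t → suc t < J ∸ i → R (w (i + t)) (w (i + suc t))
      steps t _ = subst (λ k → R (w (i + t)) (w k)) (sym (+-suc i t)) (step (i + t))

      closing : ∀ t → suc t ≡ J ∸ i → R (w (i + t)) (w (i + 0))
      closing t 1+t≡L = subst (R (w (i + t)))
        (trans (cong w (trans (sym (+-suc i t)) (trans (cong (i +_) 1+t≡L) i+L≡J)))
               (trans (sym wi≡wJ) (cong w (sym (+-identityʳ i)))))
        (step (i + t))

  path : (ℕ → Fin n) → ℕ → List (Fin n × Fin n)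
  path w zero    = []
  path w (suc k) = (w 1 , w 0) ∷ path (w ∘ suc) k

  length-path : ∀ w k → length (path w k) ≡ k
  length-path w zero    = refl
  length-path w (suc k) = cong suc (length-path (w ∘ suc) k)

  all-path : ∀ {P : Fin n × Fin n → Set} w k → (∀ t → t < k → P (w (suc t) , w t)) → All P (path w k)
  all-path w zero    _ = []
  all-path w (suc k) P = P 0 (s≤s z≤n) ∷ all-path (w ∘ suc) k (λ t t<k → P (suc t) (s≤s t<k))

  path-pruning : ∀ w k → (∀ t → t < k → Adj G (w (suc t)) (w t)) →
                 (∀ x y → x ≤ k → y ≤ k → w x ≡ w y → x ≡ y) → Pruning (path w k)
  path-pruning w zero    _   _         = []
  path-pruning w (suc k) adj injective =
    prune (adj 0 (s≤s z≤n))
      (all-path (w ∘ suc) k λ t t<k →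
        [ (λ e → 1+n≢0 (injective (suc (suc t)) 0 (s≤s t<k) z≤n e)) ,
          (λ e → 1+n≢0 (injective (suc t) 0 (s≤s (<⇒≤ t<k)) z≤n e)) ])
      (path-pruning (w ∘ suc) k (λ t t<k → adj (suc t) (s≤s t<k))
        (λ x y x≤k y≤k e → suc-injective (injective (suc x) (suc y) (s≤s x≤k) (s≤s y≤k) e)))

  module OnCycle {L : ℕ} {c : Fin L → Fin n} (c-cycle : IsCycle G L c) where

    private instance
      L-nonZero : NonZero L
      L-nonZero = >-nonZero (≤-trans (s≤s z≤n) (proj₁ c-cycle))

    around : ℕ → Fin n
    around k = c (k mod L)

    private
      toℕ-mod< : ∀ {k} → k < L → toℕ (k mod L) ≡ k
      toℕ-mod< k<L = trans (toℕ-fromℕ< _) (m<n⇒m%n≡m k<L)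

    around-toℕ : ∀ t → around (toℕ t) ≡ c t
    around-toℕ t = cong c (toℕ-mod t)

    around-injective : ∀ x y → x < L → y < L → around x ≡ around y → x ≡ y
    around-injective x y x<L y<L e =
      trans (sym (toℕ-mod< x<L)) (trans (cong toℕ (proj₁ (proj₂ c-cycle) e)) (toℕ-mod< y<L))

    around-succ : ∀ k → suc k < L → CycSucc L (k mod L) (suc k mod L)
    around-succ k 1+k<L = inj₁ (trans (toℕ-mod< 1+k<L) (cong suc (sym (toℕ-mod< (<-trans (n<1+n k) 1+k<L)))))

    around-adj : ∀ k → suc k < L → Adj G (around k) (around (suc k))
    around-adj k 1+k<L = proj₂ (proj₂ c-cycle) _ _ (around-succ k 1+k<L)

    arc-cycle : ∀ a d → 2 ≤ d → a + d < L → Adj G (around (a + d)) (around a) → CycleAlong (Adj G)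
    arc-cycle a d d≥2 a+d<L closing = segment-cycle id (λ k → around (a + k)) (suc d) (s≤s d≥2)
      (λ x y x≤d y≤d e → +-cancelˡ-≡ a x y (around-injective _ _ (in-range x≤d) (in-range y≤d) e))
      (λ t 1+t≤d → subst (λ k → Adj G (around (a + t)) (around k)) (sym (+-suc a t))
                     (around-adj (a + t) (subst (_< L) (+-suc a t) (in-range 1+t≤d))))
      (λ t 1+t≡1+d → subst₂ (Adj G) (cong (λ k → around (a + k)) (sym (suc-injective 1+t≡1+d)))
                                    (cong around (sym (+-identityʳ a))) closing)
      where
      in-range : ∀ {x} → x < suc d → a + x < L
      in-range x<1+d = ≤-<-trans (+-monoʳ-≤ a (s≤s⁻¹ x<1+d)) a+d<L

  module _ {g : ℕ} (girth : HasGirth G g) {c : Fin g → Fin n} (c-cycle : IsCycle G g c) where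

    open OnCycle c-cycle

    private
      ordered-chordless : ∀ p q → toℕ p < toℕ q → Adj G (c p) (c q) → CycSucc g p q ⊎ CycSucc g q p
      ordered-chordless p q p<q pq with toℕ q ≟ℕ suc (toℕ p)
      ... | yes q≡1+p = inj₁ (inj₁ q≡1+p)
      ... | no  q≢1+p with (toℕ p ≟ℕ 0) ×-dec (suc (toℕ q) ≟ℕ g)
      ...   | yes wraps    = inj₂ (inj₂ wraps)
      ...   | no  no-wrap  = contradiction (proj₂ girth _ _ (proj₁ (proj₂ (proj₂ chord-cycle)))) (<⇒≱ 1+d<g)
        where
        a = toℕ p
        b = toℕ q
        d = b ∸ a
        a+d≡b : a + d ≡ b
        a+d≡b = m+[n∸m]≡n (<⇒≤ p<q)

        at-least-2 : ∀ d → a + d ≡ b → 2 ≤ d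
        at-least-2 0 e = contradiction (trans (sym (+-identityʳ a)) e) (<⇒≢ p<q)
        at-least-2 1 e = contradiction (trans (sym e) (+-comm a 1)) q≢1+p
        at-least-2 (suc (suc _)) _ = s≤s (s≤s z≤n)

        chord-cycle : CycleAlong (Adj G)
        chord-cycle = arc-cycle a d (at-least-2 d a+d≡b) (subst (_< g) (sym a+d≡b) (toℕ<n q))
          (subst₂ (Adj G) (trans (sym (around-toℕ q)) (cong around (sym a+d≡b))) (sym (around-toℕ p)) (adj-sym pq))

        1+d<g : suc d < g
        1+d<g with a ≟ℕ 0
        ... | yes a≡0 = ≤∧≢⇒< (subst (λ k → suc k ≤ g) b≡d (toℕ<n q))
                               (λ 1+d≡g → no-wrap (a≡0 , trans (cong suc b≡d) 1+d≡g))
          where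
          b≡d : b ≡ d
          b≡d = trans (sym a+d≡b) (cong (_+ d) a≡0)
        ... | no  a≢0 = ≤-<-trans (+-monoˡ-≤ d (n≢0⇒n>0 a≢0)) (subst (_< g) (sym a+d≡b) (toℕ<n q))

    shortest-cycle-chordless : ∀ p q → Adj G (c p) (c q) → CycSucc g p q ⊎ CycSucc g q p
    shortest-cycle-chordless p q pq with <-cmp (toℕ p) (toℕ q)
    ... | tri< p<q _ _ = ordered-chordless p q p<q pq
    ... | tri≈ _ p≡q _ = contradiction (cong c (toℕ-injective p≡q)) (adj-irrefl pq)
    ... | tri> _ _ q<p = swap (ordered-chordless q p q<p (adj-sym pq))

module EdgeSets {n s : ℕ} {G : Graph n} (E : EdgeEnum G s) where

  open EdgeEnum E
  open Graphs G
  open Counting using (∈-─⁺; injection⇒length≤; filter-length-partition; sublist-and-extra)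
  open CyclicOrder using (next; cycSucc-next; cycSucc-no-return)
  open import Data.Nat using (zero; _<_; z≤n; s≤s; s≤s⁻¹)
  open import Data.Nat.Properties using (≤-refl; ≤-trans; ≤-antisym; <⇒≱; 1+n≰n; m+[n∸m]≡n)
  open import Data.Nat.Properties using () renaming (_≟_ to _≟ℕ_)
  open import Data.Fin.Properties using (_≟_; any?)
  open import Data.List using (List; []; _∷_; length; filter)
  open import Data.List.Properties using (length-tabulate; length-removeAt′)
  open import Data.List.Membership.Propositional using (_∈_; _∉_; find; lose)
  open import Data.List.Membership.Propositional.Properties using (∈-filter⁺; ∈-filter⁻)
  open import Data.List.Relation.Unary.Any as Any using (Any; here; there; index; _─_)
  open import Data.List.Relation.Unary.All as All using (All; []; _∷_)
  open import Data.List.Relation.Unary.AllPairs using ([]; _∷_)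
  open import Data.List.Relation.Unary.Unique.Propositional using (Unique)
  open import Data.List.Relation.Unary.Unique.Propositional.Properties using (filter⁺; allFin⁺)
  open import Data.Product using (Σ; ∃; ∃₂; _,_; proj₁; proj₂; uncurry)
  open import Data.Sum using (_⊎_; inj₁; inj₂; swap; [_,_])
  open import Function using (case_of_)
  open import Relation.Binary.PropositionalEquality using (refl; sym; trans; cong; subst; subst₂; _≢_)
  open import Relation.Nullary using (yes; no; contradiction)
  open import Relation.Nullary.Decidable using (_⊎-dec_)
  open import Relation.Unary using (Decidable)
  open import Relation.Unary.Properties using (∁?)

  sameEdge-sym : ∀ {a b c d} → SameEdge {n} a b c d → SameEdge c d a b
  sameEdge-sym (inj₁ (refl , refl)) = inj₁ (refl , refl)
  sameEdge-sym (inj₂ (refl , refl)) = inj₂ (refl , refl)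

  sameEdge-swap : ∀ {a b c d} → SameEdge {n} a b c d → SameEdge b a c d
  sameEdge-swap (inj₁ (refl , refl)) = inj₂ (refl , refl)
  sameEdge-swap (inj₂ (refl , refl)) = inj₁ (refl , refl)

  sameEdge-trans : ∀ {a b c d e f} → SameEdge {n} a b c d → SameEdge c d e f → SameEdge a b e f
  sameEdge-trans (inj₁ (refl , refl)) q = q
  sameEdge-trans (inj₂ (refl , refl)) q = sameEdge-swap q

  sameEdge-adj : ∀ {x y i} → SameEdge x y (u i) (v i) → Adj G x y
  sameEdge-adj {i = i} (inj₁ (refl , refl)) = isEdge i
  sameEdge-adj {i = i} (inj₂ (refl , refl)) = adj-sym (isEdge i)

  EdgeOf : List (Fin s) → Fin n → Fin n → Set
  EdgeOf F x y = Any (λ i → SameEdge x y (u i) (v i)) F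

  edgeOf-adj : ∀ {F x y} → EdgeOf F x y → Adj G x y
  edgeOf-adj xy = sameEdge-adj (proj₂ (proj₂ (find xy)))

  edgeOf-swap : ∀ {F x y} → EdgeOf F x y → EdgeOf F y x
  edgeOf-swap = Any.map sameEdge-swap

  edgeOf-mono : ∀ {F F' x y} → (∀ {i} → i ∈ F' → i ∈ F) → EdgeOf F' x y → EdgeOf F x y
  edgeOf-mono F'⊆F xy = let (i , i∈F' , same) = find xy in lose (F'⊆F i∈F') same

  CycleIn : List (Fin s) → Set
  CycleIn F = CycleAlong (EdgeOf F)

  record Prunable (F : List (Fin s)) : Set where
    field
      pairs    : List (Fin n × Fin n)
      pruning  : Pruning pairs
      length≡  : length pairs ≡ length F
      sound    : All (uncurry (EdgeOf F)) pairs
      covering : All (λ i → Any (uncurry (SameEdge (u i) (v i))) pairs) F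

  EdgeSetOfCycle : List (Fin s) → ∀ L → (Fin L → Fin n) → Set
  EdgeSetOfCycle F L c = IsCycle G L c × (∀ j j' → CycSucc L j j' → EdgeOf F (c j) (c j')) ×
    (∀ {i} → i ∈ F → ∃₂ λ j j' → CycSucc L j j' × SameEdge (u i) (v i) (c j) (c j'))

  module CycleEdges {F : List (Fin s)} {L : ℕ} {c : Fin L → Fin n} (c-cycle : IsCycle G L c)
                    (along : ∀ j j' → CycSucc L j j' → EdgeOf F (c j) (c j')) where

    private
      edge-spec : ∀ t → ∃ λ i → i ∈ F × SameEdge (c t) (c (next t)) (u i) (v i)
      edge-spec t = find (along t (next t) (cycSucc-next t))

    edgeAt : Fin L → Fin s
    edgeAt t = proj₁ (edge-spec t)

    edgeAt-∈ : ∀ t → edgeAt t ∈ F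
    edgeAt-∈ t = proj₁ (proj₂ (edge-spec t))

    edgeAt-same : ∀ t → SameEdge (c t) (c (next t)) (u (edgeAt t)) (v (edgeAt t))
    edgeAt-same t = proj₂ (proj₂ (edge-spec t))

    edgeAt-injective : ∀ {t t'} → edgeAt t ≡ edgeAt t' → t ≡ t'
    edgeAt-injective {t} {t'} same
      with sameEdge-trans (edgeAt-same t)
             (sameEdge-sym (subst (λ i → SameEdge (c t') (c (next t')) (u i) (v i)) (sym same) (edgeAt-same t')))
    ... | inj₁ (ct≡ct' , _) = injective ct≡ct'
      where injective = proj₁ (proj₂ c-cycle)
    ... | inj₂ (ct≡ct'⁺ , ct⁺≡ct') = contradiction
      (subst (CycSucc L t') (sym (injective ct≡ct'⁺)) (cycSucc-next t'))
      (cycSucc-no-return (proj₁ c-cycle) (subst (CycSucc L t) (injective ct⁺≡ct') (cycSucc-next t)))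
      where injective = proj₁ (proj₂ c-cycle)

    cycle-length≤ : L ≤ length F
    cycle-length≤ = subst (_≤ length F) (length-tabulate {n = L} (λ t → t))
      (injection⇒length≤ (allFin⁺ L) (λ {t} _ → edgeAt t) (λ _ _ → edgeAt-injective) (λ {t} _ → edgeAt-∈ t))

    -- A cycle as long as F uses every edge of F: otherwise its edges would fit into F minus one edge.
    cycle-covers : length F ≡ L → ∀ {i} → i ∈ F → ∃ λ t → edgeAt t ≡ i
    cycle-covers F≡L {i} i∈F with any? (λ t → edgeAt t ≟ i)
    ... | yes hit = hit
    ... | no  miss = contradiction (subst (_≤ length (F ─ i∈F)) L≡1+r L≤r) 1+n≰n
      where
      L≡1+r : L ≡ suc (length (F ─ i∈F))
      L≡1+r = trans (sym F≡L) (length-removeAt′ F (index i∈F))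
      L≤r : L ≤ length (F ─ i∈F)
      L≤r = subst (_≤ length (F ─ i∈F)) (length-tabulate {n = L} (λ t → t))
        (injection⇒length≤ {ys = F ─ i∈F} (allFin⁺ L) (λ {t} _ → edgeAt t) (λ _ _ → edgeAt-injective)
          (λ {t} _ → ∈-─⁺ i∈F (edgeAt-∈ t) (λ e → miss (t , e))))

    cycle-edge-set : length F ≡ L → EdgeSetOfCycle F L c
    cycle-edge-set F≡L = c-cycle , along , λ i∈F →
      let (t , edgeAt≡i) = cycle-covers F≡L i∈F
      in t , next t , cycSucc-next t ,
         sameEdge-sym (subst (λ i → SameEdge (c t) (c (next t)) (u i) (v i)) edgeAt≡i (edgeAt-same t))

  Incident : Fin n → Fin s → Set
  Incident z i = u i ≡ z ⊎ v i ≡ z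

  incident? : ∀ z → Decidable (Incident z)
  incident? z i = (u i ≟ z) ⊎-dec (v i ≟ z)

  touches-incident : ∀ {z x y i} → SameEdge x y (u i) (v i) → Touches z (x , y) → Incident z i
  touches-incident (inj₁ (refl , refl)) x∨y≡z = x∨y≡z
  touches-incident (inj₂ (refl , refl)) x∨y≡z = swap x∨y≡z

  other-end : ∀ {z i} → Incident z i → ∃ λ o → SameEdge z o (u i) (v i)
  other-end {i = i} (inj₁ refl) = v i , inj₁ (refl , refl)
  other-end {i = i} (inj₂ refl) = u i , inj₂ (refl , refl)

  incidences : List (Fin s) → Fin n → List (Fin s)
  incidences F z = filter (incident? z) F

  without : Fin n → List (Fin s) → List (Fin s)
  without z F = filter (∁? (incident? z)) F

  module _ {F : List (Fin s)} (F-unique : Unique F) where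

    private
      from-incidences : ∀ {x i} → i ∈ incidences F x → i ∈ F × Incident x i
      from-incidences {x} = ∈-filter⁻ (incident? x) {xs = F}

    another-incidence : ∀ {x e} → e ∈ F → Incident x e → length (incidences F x) ≢ 1 →
                        ∃ λ e' → e' ∈ F × Incident x e' × e' ≢ e
    another-incidence {x} {e} e∈F xe not-leaf with incidences F x in eq
    ... | []          = case subst (e ∈_) eq (∈-filter⁺ (incident? x) e∈F xe) of λ ()
    ... | _ ∷ []      = contradiction refl not-leaf
    ... | e₁ ∷ e₂ ∷ _ with e₁ ≟ e | subst Unique eq (filter⁺ (incident? x) F-unique)
    ...   | yes refl | (e≢e₂ ∷ _) ∷ _ =
      let (e₂∈F , xe₂) = from-incidences (subst (_ ∈_) (sym eq) (there (here refl)))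
      in e₂ , e₂∈F , xe₂ , λ e₂≡e → e≢e₂ (sym e₂≡e)
    ...   | no  e₁≢e | _ =
      let (e₁∈F , xe₁) = from-incidences (subst (_ ∈_) (sym eq) (here refl))
      in e₁ , e₁∈F , xe₁ , e₁≢e

    continue : (∀ z → length (incidences F z) ≢ 1) → ∀ {p x} → EdgeOf F p x → ∃ λ y → y ≢ p × EdgeOf F x y
    continue no-leaf {p} {x} px with find px
    ... | e , e∈F , pxe with another-incidence e∈F (touches-incident pxe (inj₂ refl)) (no-leaf x)
    ... | e' , e'∈F , xe' , e'≢e with other-end xe'
    ... | y , xye' with y ≟ p
    ... | no  y≢p = y , y≢p , lose e'∈F xye'
    ... | yes refl = contradiction (distinct e' e (sameEdge-trans (sameEdge-sym xye') (sameEdge-swap pxe))) e'≢e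

    -- Without leaves, every edge can be continued without backtracking; such a walk closes a cycle.
    no-leaf-cycle : (∀ z → length (incidences F z) ≢ 1) → ∀ {i} → i ∈ F → CycleIn F
    no-leaf-cycle no-leaf {i} i∈F = walk-cycle edgeOf-adj walk (λ t → proj₂ (state t)) no-backtrack
      where
      State = Σ (Fin n × Fin n) (uncurry (EdgeOf F))

      step : State → State
      step ((p , x) , px) = (x , proj₁ (continue no-leaf px)) , proj₂ (proj₂ (continue no-leaf px))

      state : ℕ → State
      state zero    = (u i , v i) , lose i∈F (inj₁ (refl , refl))
      state (suc t) = step (state t)

      walk : ℕ → Fin n
      walk t = proj₁ (proj₁ (state t))

      no-backtrack : ∀ t → walk (suc (suc t)) ≢ walk t
      no-backtrack t = proj₁ (proj₂ (continue no-leaf (proj₂ (state t))))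

    without-⊆ : ∀ {z i} → i ∈ without z F → i ∈ F
    without-⊆ {z} i∈ = proj₁ (∈-filter⁻ (∁? (incident? z)) {xs = F} i∈)

    without-length : ∀ {z} → length (incidences F z) ≡ 1 → suc (length (without z F)) ≡ length F
    without-length {z} one = trans (cong (_+ length (without z F)) (sym one)) (filter-length-partition (incident? z) F)

    remove-leaf : ∀ {z} → length (incidences F z) ≡ 1 →
                  Prunable (without z F) ⊎ CycleIn (without z F) → Prunable F ⊎ CycleIn F
    remove-leaf one (inj₂ (L , c , c-cycle , along)) =
      inj₂ (L , c , c-cycle , λ j j' jj' → edgeOf-mono without-⊆ (along j j' jj'))
    remove-leaf {z} one (inj₁ P') with incidences F z in eq
    ... | []          = contradiction one λ ()
    ... | _ ∷ _ ∷ _   = contradiction one λ ()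
    ... | e ∷ []      = inj₁ record
      { pairs    = (o , z) ∷ pairs P'
      ; pruning  = prune (sameEdge-adj oz) (All.map avoids-z (sound P')) (pruning P')
      ; length≡  = trans (cong suc (length≡ P')) (without-length (cong length eq))
      ; sound    = lose e∈F oz ∷ All.map (edgeOf-mono without-⊆) (sound P')
      ; covering = All.tabulate covered
      }
      where
      open Prunable
      e-spec = ∈-filter⁻ (incident? z) {xs = F} (subst (e ∈_) (sym eq) (here refl))
      e∈F = proj₁ e-spec
      o = proj₁ (other-end (proj₂ e-spec))
      oz : SameEdge o z (u e) (v e)
      oz = sameEdge-swap (proj₂ (other-end (proj₂ e-spec)))

      avoids-z : ∀ {q} → uncurry (EdgeOf (without z F)) q → ¬ Touches z q
      avoids-z xy touches = let (i , i∈ , same) = find xy in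
        proj₂ (∈-filter⁻ (∁? (incident? z)) {xs = F} i∈) (touches-incident same touches)

      covered : ∀ {i} → i ∈ F → Any (uncurry (SameEdge (u i) (v i))) ((o , z) ∷ pairs P')
      covered {i} i∈F with incident? z i
      ... | yes at-z with subst (i ∈_) eq (∈-filter⁺ (incident? z) i∈F at-z)
      ...   | here refl = here (sameEdge-sym oz)
      covered {i} i∈F | no not-at-z = there (All.lookup (covering P') (∈-filter⁺ (∁? (incident? z)) i∈F not-at-z))

  prunable-or-cycle : ∀ F → Unique F → Prunable F ⊎ CycleIn F
  prunable-or-cycle F = by-size (length F) F ≤-refl
    where
    by-size : ∀ k F → length F ≤ k → Unique F → Prunable F ⊎ CycleIn F
    by-size _       []        _  _        =
      inj₁ record { pairs = [] ; pruning = [] ; length≡ = refl ; sound = [] ; covering = [] }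
    by-size zero    (_ ∷ _)   () _
    by-size (suc k) F@(i ∷ _) F≤ F-unique with any? (λ z → length (incidences F z) ≟ℕ 1)
    ... | yes (z , one) = remove-leaf F-unique one
      (by-size k (without z F) (s≤s⁻¹ (subst (_≤ suc k) (sym (without-length F-unique one)) F≤))
                 (filter⁺ (∁? (incident? z)) F-unique))
    ... | no  no-leaf   = inj₂ (no-leaf-cycle F-unique (λ z one → no-leaf (z , one)) (here refl))

  module _ {g : ℕ} (girth : HasGirth G g) where

    short⇒prunable : ∀ {F} → Unique F → length F < g → Prunable F
    short⇒prunable {F} F-unique F<g with prunable-or-cycle F F-unique
    ... | inj₁ P = P
    ... | inj₂ (L , c , c-cycle , along) =
      contradiction (≤-trans (proj₂ girth L c c-cycle) (CycleEdges.cycle-length≤ c-cycle along)) (<⇒≱ F<g)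

    girth-sized : ∀ {F} → Unique F → length F ≡ g → Prunable F ⊎ ∃ (EdgeSetOfCycle F g)
    girth-sized {F} F-unique F≡g with prunable-or-cycle F F-unique
    ... | inj₁ P = inj₁ P
    ... | inj₂ (L , c , c-cycle , along)
      with ≤-antisym (subst (L ≤_) F≡g (CycleEdges.cycle-length≤ c-cycle along)) (proj₂ girth L c c-cycle)
    ...   | refl = inj₂ (c , CycleEdges.cycle-edge-set c-cycle along F≡g)

    module _ {F : List (Fin s)} {c : Fin g → Fin n} {e : Fin s} (c-cycle : IsCycle G g c)
             (along : ∀ j j' → CycSucc g j j' → EdgeOf F (c j) (c j')) where

      open OnCycle c-cycle

      private
        1+[g∸1]≡g : suc (g ∸ 1) ≡ g
        1+[g∸1]≡g = m+[n∸m]≡n (≤-trans (s≤s z≤n) (proj₁ c-cycle))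

        below-g : ∀ {t} → t ≤ g ∸ 1 → t < g
        below-g t≤g-1 = subst (_ <_) 1+[g∸1]≡g (s≤s t≤g-1)

        leaf-outside : ∀ {x y} → SameEdge x y (u e) (v e) → (∀ t → c t ≢ y) →
                       ∃ λ ps → Pruning ps × length ps ≡ g × All (uncurry (EdgeOf (e ∷ F))) ps
        leaf-outside {x} {y} xy-e y-off =
          (x , y) ∷ path around (g ∸ 1) ,
          prune (sameEdge-adj xy-e) (all-path around (g ∸ 1) (λ t _ → [ y-off _ , y-off _ ]))
            (path-pruning around (g ∸ 1) (λ t t<g-1 → adj-sym (around-adj t (below-g t<g-1)))
              (λ x y x≤g-1 y≤g-1 → around-injective x y (below-g x≤g-1) (below-g y≤g-1))) ,
          trans (cong suc (length-path around (g ∸ 1))) 1+[g∸1]≡g ,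
          here xy-e ∷ all-path around (g ∸ 1)
                        (λ t t<g-1 → there (edgeOf-swap (along _ _ (around-succ t (below-g t<g-1)))))

      -- Some endpoint of e lies off the cycle, as an edge joining two cycle vertices would be a chord;
      -- e followed by the cycle minus one edge is then a pruning.
      cycle-with-extra-edge : e ∉ F → ∃ λ ps → Pruning ps × length ps ≡ g × All (uncurry (EdgeOf (e ∷ F))) ps
      cycle-with-extra-edge e∉F with any? (λ t → c t ≟ u e) | any? (λ t → c t ≟ v e)
      ... | no u-off | _        = leaf-outside (inj₂ (refl , refl)) λ t e → u-off (t , e)
      ... | yes _    | no v-off = leaf-outside (inj₁ (refl , refl)) λ t e → v-off (t , e)
      ... | yes (p , cp≡ue) | yes (q , cq≡ve) = contradiction (subst (_∈ F) (sym e≡i) i∈F) e∉F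
        where
        pq-in-F : EdgeOf F (c p) (c q)
        pq-in-F with shortest-cycle-chordless girth c-cycle p q (subst₂ (Adj G) (sym cp≡ue) (sym cq≡ve) (isEdge e))
        ... | inj₁ pq = along p q pq
        ... | inj₂ qp = edgeOf-swap (along q p qp)
        i = proj₁ (find pq-in-F)
        i∈F = proj₁ (proj₂ (find pq-in-F))
        e≡i = distinct e i (subst₂ (λ x y → SameEdge x y (u i) (v i)) cp≡ue cq≡ve (proj₂ (proj₂ (find pq-in-F))))

    girth+1⇒pruning : ∀ {F} → Unique F → g < length F →
                      ∃ λ ps → Pruning ps × length ps ≡ g × All (uncurry (EdgeOf F)) ps
    girth+1⇒pruning F-unique g<F
      with sublist-and-extra g F-unique g<F
    ... | Fg , e , Fg-unique , Fg≡g , e∉Fg , e∈F , Fg⊆F with girth-sized Fg-unique Fg≡g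
    ... | inj₁ P = pairs , pruning , trans length≡ Fg≡g , All.map (edgeOf-mono Fg⊆F) sound
      where open Prunable P
    ... | inj₂ (c , c-cycle , along , _) =
      let (ps , P , ps≡g , ps-edges) = cycle-with-extra-edge c-cycle along e∉Fg
      in ps , P , ps≡g , All.map (edgeOf-mono λ { (here refl) → e∈F ; (there i∈Fg) → Fg⊆F i∈Fg }) ps-edges

module Transversals {n m : ℕ} {G : Graph n} (C : Cover G m) where

  open Cover C
  open Counting
  open import Data.Nat using (_*_)
  open import Data.Nat.Properties using (≤-antisym)
  open import Data.Fin.Properties using (_≟_)
  open import Data.Fin.Subset using (Subset; _∈_; _⊆_; ⁅_⁆; _∪_; _∩_; ∁)
  open import Function using (_∘_)
  open import Data.Fin.Subset.Properties
    using (_∈?_; ⊆-antisym; x∈⁅x⁆; x∈⁅y⁆⇒x≡y; x∈p∪q⁺; x∈p∪q⁻; x∈p∩q⁺; x∈p∩q⁻;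
           x∈∁p⇒x∉p; x∉p⇒x∈∁p)
  open import Data.List using (length; filter; allFin; cartesianProduct)
  open import Data.List.Membership.Propositional using () renaming (_∈_ to _∈ˡ_)
  open import Data.List.Membership.Propositional.Properties
    using (∈-filter⁺; ∈-filter⁻; ∈-allFin; ∈-cartesianProduct⁺; ∈-cartesianProduct⁻)
  open import Data.List.Relation.Unary.Unique.Propositional.Properties using (filter⁺; allFin⁺; cartesianProduct⁺)
  open import Data.Product using (∃; _,_; proj₁; proj₂)
  open import Data.Sum using (inj₁; inj₂)
  open import Level using (0ℓ)
  open import Relation.Binary.PropositionalEquality
    using (refl; sym; trans; cong; cong₂; subst; _≢_; module ≡-Reasoning)
  open import Relation.Nullary using (yes; no; contradiction)
  open import Relation.Nullary.Decidable using (_×-dec_)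
  open import Relation.Unary using (Pred; Decidable)

  Transversal : Pred (Subset N) _
  Transversal = InU C

  count : ∀ {ℓ} {P : Pred (Subset N) ℓ} → Decidable P → ℕ
  count P? = length (filter P? (allSubsets N))

  count-mono : ∀ {p q} {P : Pred (Subset N) p} {Q : Pred (Subset N) q} (P? : Decidable P) (Q? : Decidable Q) →
               (∀ {I} → P I → Q I) → count P? ≤ count Q?
  count-mono P? Q? = filter-length-mono P? Q? (allSubsets-unique N)

  count-cong : ∀ {p q} {P : Pred (Subset N) p} {Q : Pred (Subset N) q} (P? : Decidable P) (Q? : Decidable Q) →
               (∀ {I} → P I → Q I) → (∀ {I} → Q I → P I) → count P? ≡ count Q?
  count-cong P? Q? = filter-length-cong P? Q? (allSubsets-unique N)

  module _ {I : Subset N} (t : Transversal I) (v : Fin n) where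

    private
      pick-spec : ∃ λ x → (lab x ≡ v × x ∈ I) × (∀ {y} → y ∈ˡ allFin N → lab y ≡ v × y ∈ I → y ≡ x)
      pick-spec = filter-length≡1⇒∃! (λ x → (lab x ≟ v) ×-dec (x ∈? I)) (allFin N) (t v)

    pick : Fin N
    pick = proj₁ pick-spec

    pick-lab : lab pick ≡ v
    pick-lab = proj₁ (proj₁ (proj₂ pick-spec))

    pick-∈ : pick ∈ I
    pick-∈ = proj₂ (proj₁ (proj₂ pick-spec))

    pick-unique : ∀ {x} → x ∈ I → lab x ≡ v → x ≡ pick
    pick-unique x∈I x-v = proj₂ (proj₂ pick-spec) (∈-allFin _) (x-v , x∈I)

  transversal-unique : ∀ {I} → Transversal I → ∀ {x y} → x ∈ I → y ∈ I → lab x ≡ lab y → x ≡ y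
  transversal-unique t x∈I y∈I x-y = trans (pick-unique t _ x∈I x-y) (sym (pick-unique t _ y∈I refl))

  transversal-⊆⇒≡ : ∀ {I J} → Transversal I → Transversal J → I ⊆ J → I ≡ J
  transversal-⊆⇒≡ {I} {J} tI tJ I⊆J = ⊆-antisym I⊆J J⊆I
    where
    J⊆I : J ⊆ I
    J⊆I {x} x∈J = subst (_∈ I)
      (transversal-unique tJ (I⊆J (pick-∈ tI (lab x))) x∈J (pick-lab tI (lab x)))
      (pick-∈ tI (lab x))

  transversal-intro : ∀ {I} →
    (∀ v → ∃ λ x → lab x ≡ v × x ∈ I × (∀ {y} → y ∈ I → lab y ≡ v → y ≡ x)) → Transversal I
  transversal-intro {I} choose v =
    let (x , x-v , x∈I , unique) = choose v
    in ∃!⇒filter-length≡1 (λ x → (lab x ≟ v) ×-dec (x ∈? I)) (allFin⁺ N) (∈-allFin x) (x-v , x∈I)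
         (λ (y-v , y∈I) → unique y∈I y-v)

  fibre : Fin n → Subset N
  fibre b = toSubset (λ x → lab x ≟ b)

  ∈-fibre⁺ : ∀ {b x} → lab x ≡ b → x ∈ fibre b
  ∈-fibre⁺ {b} = ∈-toSubset⁺ (λ x → lab x ≟ b)

  ∈-fibre⁻ : ∀ {b x} → x ∈ fibre b → lab x ≡ b
  ∈-fibre⁻ {b} = ∈-toSubset⁻ (λ x → lab x ≟ b)

  infix 4 _⊆_off_
  _⊆_off_ : Subset N → Subset N → Fin n → Set
  I ⊆ J off b = ∀ {x} → lab x ≢ b → x ∈ I → x ∈ J

  ⊆-by-fibre : ∀ {I J b} → I ⊆ J off b → (∀ {x} → lab x ≡ b → x ∈ I → x ∈ J) → I ⊆ J
  ⊆-by-fibre {b = b} off on {x} x∈I with lab x ≟ b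
  ... | yes x-b = on x-b x∈I
  ... | no  x≢b = off x≢b x∈I

  replaceFibre : Fin n → Fin N → Subset N → Subset N
  replaceFibre b y I = ⁅ y ⁆ ∪ (I ∩ ∁ (fibre b))

  module _ {b : Fin n} {y : Fin N} {I : Subset N} where

    ∈-replaceFibre-self : y ∈ replaceFibre b y I
    ∈-replaceFibre-self = x∈p∪q⁺ (inj₁ (x∈⁅x⁆ y))

    ∈-replaceFibre-fibre : ∀ {x} → lab x ≡ b → x ∈ replaceFibre b y I → x ≡ y
    ∈-replaceFibre-fibre x-b x∈ with x∈p∪q⁻ ⁅ y ⁆ _ x∈
    ... | inj₁ x∈⁅y⁆ = x∈⁅y⁆⇒x≡y y x∈⁅y⁆
    ... | inj₂ x∈I∖b = contradiction (∈-fibre⁺ x-b) (x∈∁p⇒x∉p (proj₂ (x∈p∩q⁻ I _ x∈I∖b)))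

    ⊆-off-replaceFibre : I ⊆ replaceFibre b y I off b
    ⊆-off-replaceFibre x≢b x∈I = x∈p∪q⁺ (inj₂ (x∈p∩q⁺ (x∈I , x∉p⇒x∈∁p (x≢b ∘ ∈-fibre⁻))))

    replaceFibre-⊆-off : lab y ≡ b → replaceFibre b y I ⊆ I off b
    replaceFibre-⊆-off y-b x≢b x∈ with x∈p∪q⁻ ⁅ y ⁆ _ x∈
    ... | inj₁ x∈⁅y⁆ = contradiction (subst (λ z → lab z ≡ b) (sym (x∈⁅y⁆⇒x≡y y x∈⁅y⁆)) y-b) x≢b
    ... | inj₂ x∈I∖b = proj₁ (x∈p∩q⁻ I _ x∈I∖b)

    replaceFibre-transversal : Transversal I → lab y ≡ b → Transversal (replaceFibre b y I)
    replaceFibre-transversal t y-b = transversal-intro choose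
      where
      choose : ∀ v → ∃ λ x → lab x ≡ v × x ∈ replaceFibre b y I × _
      choose v with v ≟ b
      ... | yes refl = y , y-b , ∈-replaceFibre-self , λ {x} x∈ x-b → ∈-replaceFibre-fibre x-b x∈
      ... | no  v≢b  = pick t v , pick-lab t v ,
                       ⊆-off-replaceFibre (λ p-b → v≢b (trans (sym (pick-lab t v)) p-b)) (pick-∈ t v) ,
                       λ {x} x∈ x-v → pick-unique t v
                         (replaceFibre-⊆-off y-b (λ x-b → v≢b (trans (sym x-v) x-b)) x∈) x-v

  -- A transversal I satisfies S exactly when its L(b)-vertex is `point`, which depends only on I
  -- outside L(b).
  record Determined (b : Fin n) (S : Pred (Subset N) 0ℓ) : Set where
    field
      point       : ∀ {I} → Transversal I → Fin N
      point-lab   : ∀ {I} (t : Transversal I) → lab (point t) ≡ b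
      point-local : ∀ {I J} (tI : Transversal I) (tJ : Transversal J) → I ⊆ J off b → point tI ≡ point tJ
      point-∈     : ∀ {I} (t : Transversal I) → S I → point t ∈ I
      ∈-point     : ∀ {I} (t : Transversal I) → point t ∈ I → S I

  module _ {b : Fin n} {S Q : Pred (Subset N) 0ℓ} (S? : Decidable S) (Q? : Decidable Q)
           (S-determined : Determined b S) (Q-local : ∀ {I J} → I ⊆ J off b → Q I → Q J) where

    open Determined S-determined

    private
      TSQ? : Decidable (λ I → Transversal I × S I × Q I)
      TSQ? I = InU? C I ×-dec (S? I ×-dec Q? I)

      TQ? : Decidable (λ I → Transversal I × Q I)
      TQ? I = InU? C I ×-dec Q? I

      TSQs = filter TSQ? (allSubsets N)
      fibreList = filter (λ y → lab y ≟ b) (allFin N)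

      determined-≡ : ∀ {J J'} (tJ : Transversal J) (tJ' : Transversal J') → S J → S J' →
                     J ⊆ J' off b → J ≡ J'
      determined-≡ tJ tJ' sJ sJ' off = transversal-⊆⇒≡ tJ tJ' (⊆-by-fibre off on)
        where
        on : ∀ {x} → lab x ≡ b → x ∈ _ → x ∈ _
        on x-b x∈J = subst (_∈ _)
          (sym (trans (transversal-unique tJ x∈J (point-∈ tJ sJ) (trans x-b (sym (point-lab tJ))))
                      (point-local tJ tJ' off)))
          (point-∈ tJ' sJ')

      extend : length (cartesianProduct TSQs fibreList) ≤ count TQ?
      extend = injection⇒length≤ (cartesianProduct⁺ (filter⁺ TSQ? (allSubsets-unique N)) (filter⁺ _ (allFin⁺ N)))
        (λ {(J , y)} _ → replaceFibre b y J) injective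
        (λ p → let ((tJ , _ , qJ) , y-b) = unpack p in
               ∈-filter⁺ TQ? (∈-allSubsets _) (replaceFibre-transversal tJ y-b , Q-local ⊆-off-replaceFibre qJ))
        where
        unpack : ∀ {J y} → (J , y) ∈ˡ cartesianProduct TSQs fibreList → (Transversal J × S J × Q J) × lab y ≡ b
        unpack p = let (J∈ , y∈) = ∈-cartesianProduct⁻ TSQs fibreList p
                   in proj₂ (∈-filter⁻ TSQ? {xs = allSubsets N} J∈) ,
                      proj₂ (∈-filter⁻ (λ y → lab y ≟ b) {xs = allFin N} y∈)
        injective : ∀ {J y J' y'} → (J , y) ∈ˡ cartesianProduct TSQs fibreList →
                    (J' , y') ∈ˡ cartesianProduct TSQs fibreList →
                    replaceFibre b y J ≡ replaceFibre b y' J' → (J , y) ≡ (J' , y')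
        injective {J} {y} {J'} {y'} p p' eq =
          let ((tJ , sJ , _) , y-b) = unpack p ; ((tJ' , sJ' , _) , y'-b) = unpack p'
              off : J ⊆ J' off b
              off x≢b x∈J = replaceFibre-⊆-off y'-b x≢b (subst (_ ∈_) eq (⊆-off-replaceFibre x≢b x∈J))
          in cong₂ _,_ (determined-≡ tJ tJ' sJ sJ' off)
                       (∈-replaceFibre-fibre y-b (subst (y ∈_) eq ∈-replaceFibre-self))

      restrict : count TQ? ≤ length (cartesianProduct TSQs fibreList)
      restrict = injection⇒length≤ (filter⁺ TQ? (allSubsets-unique N)) image injective image-∈
        where
        unpack : ∀ {I} → I ∈ˡ filter TQ? (allSubsets N) → Transversal I × Q I
        unpack p = proj₂ (∈-filter⁻ TQ? {xs = allSubsets N} p)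
        image : ∀ {I} → I ∈ˡ filter TQ? (allSubsets N) → Subset N × Fin N
        image {I} p = replaceFibre b (point (proj₁ (unpack p))) I , pick (proj₁ (unpack p)) b
        injective : ∀ {I I'} (p : I ∈ˡ _) (p' : I' ∈ˡ _) → image p ≡ image p' → I ≡ I'
        injective p p' eq = transversal-⊆⇒≡ t t' (⊆-by-fibre off on)
          where
          t = proj₁ (unpack p)
          t' = proj₁ (unpack p')
          off : _ ⊆ _ off b
          off x≢b x∈I = replaceFibre-⊆-off (point-lab t') x≢b
            (subst (_ ∈_) (cong proj₁ eq) (⊆-off-replaceFibre x≢b x∈I))
          on : ∀ {x} → lab x ≡ b → x ∈ _ → x ∈ _
          on x-b x∈I = subst (_∈ _) (sym (trans (pick-unique t b x∈I x-b) (cong proj₂ eq))) (pick-∈ t' b)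
        image-∈ : ∀ {I} (p : I ∈ˡ filter TQ? (allSubsets N)) → image p ∈ˡ cartesianProduct TSQs fibreList
        image-∈ {I} p = ∈-cartesianProduct⁺
          (∈-filter⁺ TSQ? (∈-allSubsets K) (tK , sK , Q-local ⊆-off-replaceFibre q))
          (∈-filter⁺ (λ y → lab y ≟ b) (∈-allFin _) (pick-lab t b))
          where
          t = proj₁ (unpack p)
          q = proj₂ (unpack p)
          K = replaceFibre b (point t) I
          tK = replaceFibre-transversal t (point-lab t)
          sK = ∈-point tK (subst (_∈ K) (point-local t tK ⊆-off-replaceFibre) ∈-replaceFibre-self)

    -- Replacing the L(b)-vertex is a bijection from (transversals satisfying S and Q) × L(b) onto the
    -- transversals satisfying Q.
    count-determined : count (λ I → InU? C I ×-dec (S? I ×-dec Q? I)) * m ≡ count (λ I → InU? C I ×-dec Q? I)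
    count-determined = begin
      count TSQ? * m                               ≡⟨ cong (count TSQ? *_) (fold b) ⟨
      count TSQ? * length fibreList                ≡⟨ length-cartesianProduct TSQs fibreList ⟨
      length (cartesianProduct TSQs fibreList)     ≡⟨ ≤-antisym extend restrict ⟩
      count TQ?                                    ∎
      where open ≡-Reasoning

module Constraints {n m : ℕ} {G : Graph n} (C : Cover G m) where

  open Cover C
  open Counting
  open Transversals C
  open Graphs G using (Touches; Pruning; []; prune; adj-irrefl; pruning-length<)
  open import Data.Nat using (_*_; _<_; s≤s; >-nonZero)
  open import Data.Nat.Properties
    using (*-identityˡ; *-identityʳ; *-assoc; *-cancelʳ-≡; ^-distribˡ-+-*; m^n≢0; m∸n+n≡m; m<n⇒0<n∸m;
           n≢0⇒n>0; <⇒≤; <-irrefl; n<1+n; module ≤-Reasoning)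
  open import Data.Nat.Properties using () renaming (_≟_ to _≟ℕ_)
  open import Data.Bool.Properties using (T?)
  open import Data.Fin.Properties using (_≟_; any?)
  open import Data.Fin.Subset using (Subset; _∈_)
  open import Data.Fin.Subset.Properties using (_∈?_)
  open import Data.List using (List; []; _∷_; length; map; filter; allFin; cartesianProduct)
  open import Data.List.Properties using (length-map; length-tabulate; length-removeAt′; filter-none)
  open import Data.List.Membership.Propositional using () renaming (_∈_ to _∈ˡ_)
  open import Data.List.Membership.Propositional.Properties using (∈-filter⁺; ∈-filter⁻; ∈-allFin)
  open import Data.List.Relation.Unary.Any using (here; index; _─_)
  open import Data.List.Relation.Unary.All as All using (All; []; _∷_)
  open import Data.List.Relation.Unary.All.Properties using (map⁺; map⁻)
  open import Data.List.Relation.Unary.AllPairs using ([]; _∷_)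
  open import Data.List.Relation.Unary.Unique.Propositional using (Unique)
  open import Data.List.Relation.Unary.Unique.Propositional.Properties using (filter⁺; allFin⁺; cartesianProduct⁺)
  open import Data.Product using (∃; _,_; proj₁; proj₂; uncurry)
  open import Data.Sum using (inj₁; inj₂)
  open import Function using (id; _∘_)
  open import Level using (0ℓ)
  open import Relation.Binary.PropositionalEquality
    using (refl; sym; trans; cong; cong₂; subst; subst₂; module ≡-Reasoning)
  open import Relation.Nullary using (¬_; yes; no; contradiction)
  open import Relation.Nullary.Decidable using (_×-dec_)
  open import Relation.Unary using (Pred; Decidable)

  data Constraint : Set where
    edgeBetween : Fin n → Fin n → Constraint
    pin         : Fin N → Constraint

  Holds : Constraint → Pred (Subset N) 0ℓ
  Holds (edgeBetween a b) = HasEdgeIn C a b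
  Holds (pin y)         I = y ∈ I

  holds? : ∀ c → Decidable (Holds c)
  holds? (edgeBetween a b)   = HasEdgeIn? C a b
  holds? (pin y)           I = y ∈? I

  Involves : Constraint → Fin n → Set
  Involves (edgeBetween a b) z = Touches z (a , b)
  Involves (pin y)           z = lab y ≡ z

  holds-local : ∀ {c b I J} → ¬ Involves c b → I ⊆ J off b → Holds c I → Holds c J
  holds-local {edgeBetween a a'} not-involved off (x , y , x∈ , y∈ , x-a , y-a' , xy) =
    x , y , off (λ x-b → not-involved (inj₁ (trans (sym x-a) x-b))) x∈ ,
            off (λ y-b → not-involved (inj₂ (trans (sym y-a') y-b))) y∈ , x-a , y-a' , xy
  holds-local {pin y} not-involved off y∈ = off not-involved y∈

  pin-determined : ∀ y → Determined (lab y) (Holds (pin y))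
  pin-determined y = record
    { point = λ _ → y ; point-lab = λ _ → refl ; point-local = λ _ _ _ → refl
    ; point-∈ = λ _ y∈ → y∈ ; ∈-point = λ _ y∈ → y∈ }

  module _ (full : FullEdges C) {a b : Fin n} (ab : Adj G a b) where

    -- Otherwise the m edges of E_H(L(a),L(b)) would inject, via their L(a)-ends, into L(a) ∖ {x}.
    neighbour : ∀ x → lab x ≡ a → ∃ λ y → lab y ≡ b × Adj H x y
    neighbour x x-a with any? (λ y → (lab y ≟ b) ×-dec T? (Graph.adj H x y))
    ... | yes found = found
    ... | no  none  = contradiction m<m (<-irrefl refl)
      where
      Edge? : Decidable λ (p : Fin N × Fin N) →
                lab (proj₁ p) ≡ a × lab (proj₂ p) ≡ b × Adj H (proj₁ p) (proj₂ p)
      Edge? (x₁ , y₁) = (lab x₁ ≟ a) ×-dec ((lab y₁ ≟ b) ×-dec T? (Graph.adj H x₁ y₁))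
      pairs = cartesianProduct (allFin N) (allFin N)
      fibreA = filter (λ z → lab z ≟ a) (allFin N)
      x∈A : x ∈ˡ fibreA
      x∈A = ∈-filter⁺ (λ z → lab z ≟ a) (∈-allFin x) x-a
      edges≤ : length (filter Edge? pairs) ≤ length (fibreA ─ x∈A)
      edges≤ = injection⇒length≤ (filter⁺ Edge? (cartesianProduct⁺ (allFin⁺ N) (allFin⁺ N)))
        (λ {p} _ → proj₁ p)
        (λ { {x₁ , y₁} {_ , y₂} p q refl →
             let (_ , x₁-a , y₁-b , x₁y₁) = ∈-filter⁻ Edge? {xs = pairs} p
                 (_ , _    , y₂-b , x₁y₂) = ∈-filter⁻ Edge? {xs = pairs} q
             in cong (x₁ ,_) (matching x₁ y₁ y₂ (subst₂ (Adj G) (sym x₁-a) (sym y₁-b) ab)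
                                (trans y₁-b (sym y₂-b)) x₁y₁ x₁y₂) })
        (λ { {x₁ , y₁} p →
             let (_ , x₁-a , y₁-b , x₁y₁) = ∈-filter⁻ Edge? {xs = pairs} p
             in ∈-─⁺ x∈A (∈-filter⁺ (λ z → lab z ≟ a) (∈-allFin x₁) x₁-a)
                  (λ { refl → none (y₁ , y₁-b , x₁y₁) }) })
      m<m : m < m
      m<m = begin-strict
        m                           ≡⟨ full a b ab ⟨
        length (filter Edge? pairs) ≤⟨ edges≤ ⟩
        length (fibreA ─ x∈A)       <⟨ n<1+n _ ⟩
        suc (length (fibreA ─ x∈A)) ≡⟨ length-removeAt′ fibreA (index x∈A) ⟨
        length fibreA               ≡⟨ fold a ⟩
        m                           ∎
        where open ≤-Reasoning

    neighbour-unique : ∀ {x y y'} → lab x ≡ a → lab y ≡ b → lab y' ≡ b → Adj H x y → Adj H x y' → y ≡ y'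
    neighbour-unique {x} {y} {y'} x-a y-b y'-b =
      matching x y y' (subst₂ (Adj G) (sym x-a) (sym y-b) ab) (trans y-b (sym y'-b))

    edge-determined : Determined b (Holds (edgeBetween a b))
    edge-determined = record
      { point = partner ; point-lab = partner-lab ; point-local = partner-local
      ; point-∈ = partner-∈ ; ∈-point = ∈-partner }
      where
      partner : ∀ {I} → Transversal I → Fin N
      partner t = proj₁ (neighbour (pick t a) (pick-lab t a))

      partner-lab : ∀ {I} (t : Transversal I) → lab (partner t) ≡ b
      partner-lab t = proj₁ (proj₂ (neighbour (pick t a) (pick-lab t a)))

      partner-adj : ∀ {I} (t : Transversal I) → Adj H (pick t a) (partner t)
      partner-adj t = proj₂ (proj₂ (neighbour (pick t a) (pick-lab t a)))

      partner-local : ∀ {I J} (tI : Transversal I) (tJ : Transversal J) → I ⊆ J off b → partner tI ≡ partner tJ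
      partner-local tI tJ off = neighbour-unique (pick-lab tJ a) (partner-lab tI) (partner-lab tJ)
        (subst (λ z → Adj H z (partner tI)) same-pick (partner-adj tI)) (partner-adj tJ)
        where
        same-pick : pick tI a ≡ pick tJ a
        same-pick = pick-unique tJ a
          (off (λ e → adj-irrefl ab (trans (sym (pick-lab tI a)) e)) (pick-∈ tI a)) (pick-lab tI a)

      partner-∈ : ∀ {I} (t : Transversal I) → HasEdgeIn C a b I → partner t ∈ I
      partner-∈ t (x , y , x∈ , y∈ , x-a , y-b , xy) = subst (_∈ _)
        (neighbour-unique (pick-lab t a) y-b (partner-lab t)
          (subst (λ z → Adj H z y) (pick-unique t a x∈ x-a) xy) (partner-adj t))
        y∈

      ∈-partner : ∀ {I} (t : Transversal I) → partner t ∈ I → HasEdgeIn C a b I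
      ∈-partner t partner∈ = pick t a , partner t , pick-∈ t a , partner∈ , pick-lab t a , partner-lab t , partner-adj t

  data Peeling : List Constraint → Set where
    []   : Peeling []
    peel : ∀ {c b cs} → Determined b (Holds c) → All (λ c' → ¬ Involves c' b) cs → Peeling cs →
           Peeling (c ∷ cs)

  Satisfies : List Constraint → Pred (Subset N) 0ℓ
  Satisfies cs I = All (λ c → Holds c I) cs

  satisfies? : ∀ cs → Decidable (Satisfies cs)
  satisfies? cs I = All.all? (λ c → holds? c I) cs

  #satisfying : List Constraint → ℕ
  #satisfying cs = count (λ I → InU? C I ×-dec satisfies? cs I)

  count-peeling : ∀ {cs} → Peeling cs → #satisfying cs * m ^ length cs ≡ #satisfying []
  count-peeling [] = *-identityʳ _
  count-peeling (peel {c} {b} {cs} c-determined untouched P) = begin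
    #satisfying (c ∷ cs) * (m * m ^ length cs)  ≡⟨ *-assoc (#satisfying (c ∷ cs)) m _ ⟨
    #satisfying (c ∷ cs) * m * m ^ length cs    ≡⟨ cong (λ k → k * m * m ^ length cs) split ⟩
    count (λ I → InU? C I ×-dec (holds? c I ×-dec satisfies? cs I)) * m * m ^ length cs
      ≡⟨ cong (_* m ^ length cs) (count-determined (holds? c) (satisfies? cs) c-determined local) ⟩
    #satisfying cs * m ^ length cs              ≡⟨ count-peeling P ⟩
    #satisfying []                              ∎
    where
    open ≡-Reasoning
    local : ∀ {I J} → I ⊆ J off b → Satisfies cs I → Satisfies cs J
    local off sat = All.zipWith (λ (not-involved , holds) → holds-local not-involved off holds) (untouched , sat)
    split : #satisfying (c ∷ cs) ≡ count (λ I → InU? C I ×-dec (holds? c I ×-dec satisfies? cs I))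
    split = count-cong _ _ (λ { (t , h ∷ hs) → t , h , hs }) (λ (t , h , hs) → t , h ∷ hs)

  transversal⇒1≤m : ∀ {I} → Transversal I → Fin n → 1 ≤ m
  transversal⇒1≤m {I} t v = subst₂ _≤_ (t v) (fold v)
    (filter-length-mono ((λ x → (lab x ≟ v) ×-dec (x ∈? I))) (λ x → lab x ≟ v) (allFin⁺ N) proj₁)

  no-transversals : m ≡ 0 → Fin n → ∀ cs → #satisfying cs ≡ 0
  no-transversals m≡0 v cs = cong length (filter-none (λ I → InU? C I ×-dec satisfies? cs I)
    (All.universal (λ I (t , _) → contradiction (subst (1 ≤_) m≡0 (transversal⇒1≤m t v)) λ ()) (allSubsets N)))

  fibre-inhabited : 1 ≤ m → ∀ v → ∃ λ x → lab x ≡ v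
  fibre-inhabited 1≤m v with filter (λ x → lab x ≟ v) (allFin N) in eq | fold v
  ... | []    | 0≡m = contradiction (subst (1 ≤_) (sym 0≡m) 1≤m) λ ()
  ... | x ∷ _ | _   =
    x , proj₂ (∈-filter⁻ (λ x → lab x ≟ v) {xs = allFin N} (subst (x ∈ˡ_) (sym eq) (here refl)))

  -- Pinning one vertex in every fibre leaves a single transversal, and each pin divides the count by m.
  count-transversals : 1 ≤ m → #satisfying [] ≡ m ^ n
  count-transversals 1≤m = begin
    #satisfying []                              ≡⟨ count-peeling (pins-peeling (allFin⁺ n)) ⟨
    #satisfying (pins (allFin n)) * m ^ length (pins (allFin n))
      ≡⟨ cong₂ (λ k l → k * m ^ l) #pins≡1
               (trans (length-map (pin ∘ s) (allFin n)) (length-tabulate {n = n} id)) ⟩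
    1 * m ^ n                                   ≡⟨ *-identityˡ (m ^ n) ⟩
    m ^ n                                       ∎
    where
    open ≡-Reasoning
    s : Fin n → Fin N
    s v = proj₁ (fibre-inhabited 1≤m v)
    s-lab : ∀ v → lab (s v) ≡ v
    s-lab v = proj₂ (fibre-inhabited 1≤m v)

    pins : List (Fin n) → List Constraint
    pins = map (pin ∘ s)

    pins-peeling : ∀ {vs} → Unique vs → Peeling (pins vs)
    pins-peeling {[]}     []                  = []
    pins-peeling {v ∷ vs} (v∉vs ∷ vs-unique) = peel (pin-determined (s v))
      (map⁺ (All.map (λ v≢w e → v≢w (trans (sym (s-lab v)) (trans (sym e) (s-lab _)))) v∉vs))
      (pins-peeling vs-unique)

    I₀ : Subset N
    I₀ = toSubset (λ x → x ≟ s (lab x))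

    s∈I₀ : ∀ v → s v ∈ I₀
    s∈I₀ v = ∈-toSubset⁺ (λ x → x ≟ s (lab x)) (cong s (sym (s-lab v)))

    ∈I₀⇒section : ∀ {x} → x ∈ I₀ → x ≡ s (lab x)
    ∈I₀⇒section = ∈-toSubset⁻ (λ x → x ≟ s (lab x))

    t₀ : Transversal I₀
    t₀ = transversal-intro λ v → s v , s-lab v , s∈I₀ v , λ y∈ y-v → trans (∈I₀⇒section y∈) (cong s y-v)

    #pins≡1 : #satisfying (pins (allFin n)) ≡ 1
    #pins≡1 = ∃!⇒filter-length≡1 (λ I → InU? C I ×-dec satisfies? (pins (allFin n)) I) (allSubsets-unique N)
      (∈-allSubsets I₀) (t₀ , map⁺ (All.universal s∈I₀ (allFin n)))
      (λ (t , sat) → sym (transversal-⊆⇒≡ t₀ t λ {x} x∈I₀ →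
        subst (_∈ _) (sym (∈I₀⇒section x∈I₀)) (All.lookup (map⁻ sat) (∈-allFin (lab x)))))

  edges : List (Fin n × Fin n) → List Constraint
  edges = map (uncurry edgeBetween)

  pruning-peeling : FullEdges C → ∀ {ps} → Pruning ps → Peeling (edges ps)
  pruning-peeling full []                    = []
  pruning-peeling full (prune ab avoids P) = peel (edge-determined full ab) (map⁺ avoids) (pruning-peeling full P)

  count-pruning : FullEdges C → ∀ {ps} → Pruning ps → 1 ≤ length ps → #satisfying (edges ps) ≡ m ^ (n ∸ length ps)
  count-pruning full {ps@((a , _) ∷ _)} P len≥1 with m ≟ℕ 0
  ... | yes m≡0 = begin
    #satisfying (edges ps)  ≡⟨ no-transversals m≡0 a (edges ps) ⟩
    0                       ≡⟨ zero-power (m<n⇒0<n∸m (pruning-length< P len≥1)) ⟨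
    0 ^ (n ∸ length ps)     ≡⟨ cong (_^ (n ∸ length ps)) m≡0 ⟨
    m ^ (n ∸ length ps)     ∎
    where
    open ≡-Reasoning
    zero-power : ∀ {k} → 0 < k → 0 ^ k ≡ 0
    zero-power (s≤s _) = refl
  ... | no m≢0 = *-cancelʳ-≡ _ _ (m ^ length ps) {{m^n≢0 m (length ps) {{>-nonZero (n≢0⇒n>0 m≢0)}}}} (begin
    #satisfying (edges ps) * m ^ length ps        ≡⟨ cong (λ l → #satisfying (edges ps) * m ^ l) (length-map _ ps) ⟨
    #satisfying (edges ps) * m ^ length (edges ps) ≡⟨ count-peeling (pruning-peeling full P) ⟩
    #satisfying []                                ≡⟨ count-transversals (n≢0⇒n>0 m≢0) ⟩
    m ^ n                                         ≡⟨ cong (m ^_) (m∸n+n≡m (<⇒≤ (pruning-length< P len≥1))) ⟨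
    m ^ (n ∸ length ps + length ps)               ≡⟨ ^-distribˡ-+-* m (n ∸ length ps) (length ps) ⟩
    m ^ (n ∸ length ps) * m ^ length ps           ∎)
    where open ≡-Reasoning

module Theorem {n s g m : ℕ} {G : Graph n} (E : EdgeEnum G s) (girth : HasGirth G g)
               (C : Cover G m) (full : FullEdges C) where

  open EdgeEnum E
  open Cover C using (N; H)
  open Counting using (sublist-and-extra)
  open Graphs G using (Pruning)
  open EdgeSets E
  open Transversals C using (count-mono)
  open Constraints C
  open import Data.Nat using (_<_; z≤n; s≤s)
  open import Data.Nat.Properties
    using (≤-antisym; ≤-trans; ≤-<-trans; n<1+n; +-comm; +-∸-assoc; ∸-monoˡ-≤; m+[n∸m]≡n)
  open import Data.Fin using (fromℕ<)
  import Data.Fin.Properties as Fin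
  open import Data.List using (List; length; map; allFin)
  open import Data.List.Properties using (length-map; length-tabulate)
  open import Data.List.Membership.Propositional using (_∈_; find)
  open import Data.List.Membership.Propositional.Properties using (∈-map⁺; ∈-map⁻; ∈-allFin)
  open import Data.List.Relation.Unary.Any using (Any)
  open import Data.List.Relation.Unary.All as All using (All)
  open import Data.List.Relation.Unary.All.Properties using (map⁺; map⁻)
  open import Data.List.Relation.Unary.Unique.Propositional using (Unique)
  import Data.List.Relation.Unary.Unique.Propositional.Properties as Unique
  open import Data.Product using (_,_; proj₁; proj₂; uncurry)
  open import Data.Sum using (inj₁; inj₂)
  open import Relation.Binary.Definitions using (tri<; tri≈; tri>)
  open import Relation.Binary.PropositionalEquality using (refl; sym; trans; cong; subst; module ≡-Reasoning)
  open import Relation.Nullary using (contradiction)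

  hasEdgeIn-sameEdge : ∀ {a b c d I} → SameEdge a b c d → HasEdgeIn C c d I → HasEdgeIn C a b I
  hasEdgeIn-sameEdge (inj₁ (refl , refl)) has = has
  hasEdgeIn-sameEdge (inj₂ (refl , refl)) (x , y , x∈ , y∈ , x-c , y-d , xy) =
    y , x , y∈ , x∈ , y-d , x-c , Graphs.adj-sym H xy

  module _ {k : ℕ} (idx : Fin k → Fin s) where

    edgesOf : List (Fin s)
    edgesOf = map idx (allFin k)

    length-edgesOf : length edgesOf ≡ k
    length-edgesOf = trans (length-map idx (allFin k)) (length-tabulate {n = k} (λ j → j))

    edgesOf-unique : Injective _≡_ _≡_ idx → Unique edgesOf
    edgesOf-unique idx-injective = Unique.map⁺ idx-injective (Unique.allFin⁺ k)

    interCount≤#satisfying : Fin k → ∀ {F ps} → (∀ {i} → i ∈ F → i ∈ edgesOf) →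
                             All (uncurry (EdgeOf F)) ps →
                             interCount C E idx ≤ #satisfying (edges ps)
    interCount≤#satisfying j₀ F⊆ ps-edges = count-mono _ _ λ {I} inS → proj₁ (inS j₀) ,
      map⁺ (All.map (λ xy → let (i , i∈F , same) = find xy ; (j , _ , i≡idxj) = ∈-map⁻ idx (F⊆ i∈F)
                             in hasEdgeIn-sameEdge same
                                  (subst (λ i → HasEdgeIn C (u i) (v i) I) (sym i≡idxj) (proj₂ (inS j))))
                    ps-edges)

    #satisfying≤interCount : ∀ {ps} → All (λ i → Any (uncurry (SameEdge (u i) (v i))) ps) edgesOf →
                             #satisfying (edges ps) ≤ interCount C E idx
    #satisfying≤interCount covered = count-mono _ _ λ (t , sat) j → t ,
      let (q , q∈ps , same) = find (All.lookup covered (∈-map⁺ idx (∈-allFin j)))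
      in hasEdgeIn-sameEdge same (All.lookup (map⁻ sat) q∈ps)

    interCount-prunable : 1 ≤ k → Prunable edgesOf → interCount C E idx ≡ m ^ (n ∸ k)
    interCount-prunable k≥1 P = begin
      interCount C E idx
        ≡⟨ ≤-antisym (interCount≤#satisfying (fromℕ< k≥1) (λ i∈ → i∈) sound)
                     (#satisfying≤interCount covering) ⟩
      #satisfying (edges pairs) ≡⟨ count-pruning full pruning (subst (1 ≤_) (sym pairs≡k) k≥1) ⟩
      m ^ (n ∸ length pairs)    ≡⟨ cong (λ l → m ^ (n ∸ l)) pairs≡k ⟩
      m ^ (n ∸ k)               ∎
      where
      open ≡-Reasoning
      open Prunable P
      pairs≡k = trans length≡ length-edgesOf

    interCount≤pruning : 1 ≤ k → ∀ {F ps} → (∀ {i} → i ∈ F → i ∈ edgesOf) →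
                         Pruning ps → 1 ≤ length ps →
                         All (uncurry (EdgeOf F)) ps → interCount C E idx ≤ m ^ (n ∸ length ps)
    interCount≤pruning k≥1 F⊆ P ps≥1 ps-edges =
      subst (_ ≤_) (count-pruning full P ps≥1) (interCount≤#satisfying (fromℕ< k≥1) F⊆ ps-edges)

  increasing⇒injective : ∀ {k} (idx : Fin k → Fin s) → StrictlyIncreasing idx → Injective _≡_ _≡_ idx
  increasing⇒injective idx increasing {a} {b} idx-a≡idx-b with Fin.<-cmp a b
  ... | tri< a<b _ _ = contradiction idx-a≡idx-b (Fin.<⇒≢ (increasing a b a<b))
  ... | tri≈ _ a≡b _ = a≡b
  ... | tri> _ _ b<a = contradiction (sym idx-a≡idx-b) (Fin.<⇒≢ (increasing b a b<a))

  private
    g≥3 : 3 ≤ g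
    g≥3 = proj₁ (proj₂ (proj₁ girth))

    g≥1 : 1 ≤ g
    g≥1 = ≤-trans (s≤s z≤n) g≥3

    g∸1≥1 : 1 ≤ g ∸ 1
    g∸1≥1 = ≤-trans (s≤s z≤n) (∸-monoˡ-≤ 1 g≥3)

    g≤n : g ≤ n
    g≤n = Fin.injective⇒≤ (proj₁ (proj₂ (proj₂ (proj₁ girth))))

    1+[g∸1]≡g : suc (g ∸ 1) ≡ g
    1+[g∸1]≡g = m+[n∸m]≡n g≥1

    g∸1<g : g ∸ 1 < g
    g∸1<g = subst (g ∸ 1 <_) 1+[g∸1]≡g (n<1+n (g ∸ 1))

    n∸[g∸1]≡n∸g+1 : n ∸ (g ∸ 1) ≡ n ∸ g + 1
    n∸[g∸1]≡n∸g+1 = subtract-pred g≥1 g≤n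
      where
      subtract-pred : ∀ {g} → 1 ≤ g → g ≤ n → n ∸ (g ∸ 1) ≡ n ∸ g + 1
      subtract-pred {suc g} _ g<n = trans (+-∸-assoc 1 g<n) (+-comm 1 (n ∸ suc g))

  interCount-below-girth : (k : ℕ) (idx : Fin k → Fin s) → 1 ≤ k → k ≤ g ∸ 1 → StrictlyIncreasing idx →
           interCount C E idx ≡ m ^ (n ∸ k)
  interCount-below-girth k idx k≥1 k≤g-1 increasing = interCount-prunable idx k≥1
    (short⇒prunable girth (edgesOf-unique idx (increasing⇒injective idx increasing))
      (subst (_< g) (sym (length-edgesOf idx)) (≤-<-trans k≤g-1 g∸1<g)))

  interCount-girth-bound : (idx : Fin g → Fin s) → Injective _≡_ _≡_ idx →
                           interCount C E idx ≤ m ^ (n ∸ g + 1)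
  interCount-girth-bound idx idx-injective
    with sublist-and-extra (g ∸ 1) (edgesOf-unique idx idx-injective)
           (subst (g ∸ 1 <_) (sym (length-edgesOf idx)) g∸1<g)
  ... | F , _ , F-unique , F≡g∸1 , _ , _ , F⊆ =
    subst (λ l → interCount C E idx ≤ m ^ l) (trans (cong (n ∸_) pairs≡g∸1) n∸[g∸1]≡n∸g+1)
      (interCount≤pruning idx g≥1 F⊆ pruning (subst (1 ≤_) (sym pairs≡g∸1) g∸1≥1) sound)
    where
    open Prunable (short⇒prunable girth F-unique (subst (_< g) (sym F≡g∸1) g∸1<g))
    pairs≡g∸1 = trans length≡ F≡g∸1

  interCount-girth-non-cycle : (idx : Fin g → Fin s) → Injective _≡_ _≡_ idx → ¬ EdgesOfCycle E g idx →
                  interCount C E idx ≡ m ^ (n ∸ g)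
  interCount-girth-non-cycle idx idx-injective not-cycle
    with girth-sized girth (edgesOf-unique idx idx-injective) (length-edgesOf idx)
  ... | inj₁ P = interCount-prunable idx g≥1 P
  ... | inj₂ (c , c-cycle , along , covers) = contradiction
    (c , c-cycle , (λ j → covers (∈-map⁺ idx (∈-allFin j))) , λ j₁ j₂ j₁j₂ →
      let (i , i∈ , same) = find (along j₁ j₂ j₁j₂) ; (j , _ , i≡idxj) = ∈-map⁻ idx i∈
      in j , subst (λ i → SameEdge (u i) (v i) (c j₁) (c j₂)) i≡idxj (sameEdge-sym same))
    not-cycle

  interCount-above-girth : (k : ℕ) (idx : Fin k → Fin s) → suc g ≤ k → StrictlyIncreasing idx →
             interCount C E idx ≤ m ^ (n ∸ g)
  interCount-above-girth k idx k>g increasing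
    with girth+1⇒pruning girth (edgesOf-unique idx (increasing⇒injective idx increasing))
           (subst (g <_) (sym (length-edgesOf idx)) k>g)
  ... | ps , P , ps≡g , ps-edges = subst (λ l → interCount C E idx ≤ m ^ (n ∸ l)) ps≡g
    (interCount≤pruning idx (≤-trans (s≤s z≤n) k>g) (λ i∈ → i∈) P (subst (1 ≤_) (sym ps≡g) g≥1) ps-edges)

lemma13 : (n s g m : ℕ) (G : Graph n) (E : EdgeEnum G s) →
    3 ≤ n → 3 ≤ s → HasGirth G g →
    (C : Cover G m) → FullEdges C →
    ((k : ℕ) (idx : Fin k → Fin s) → 1 ≤ k → k ≤ g ∸ 1 → StrictlyIncreasing idx →
       interCount C E idx ≡ m ^ (n ∸ k))
    × ((idx : Fin g → Fin s) → Injective _≡_ _≡_ idx →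
       (interCount C E idx ≤ m ^ (n ∸ g + 1))
       × (¬ EdgesOfCycle E g idx → interCount C E idx ≡ m ^ (n ∸ g)))
    × ((k : ℕ) (idx : Fin k → Fin s) → suc g ≤ k → StrictlyIncreasing idx →
       interCount C E idx ≤ m ^ (n ∸ g))
lemma13 n s g m G E _ _ girth C full =
  interCount-below-girth ,
  (λ idx idx-injective → interCount-girth-bound idx idx-injective , interCount-girth-non-cycle idx idx-injective) ,
  interCount-above-girth
  where open Theorem E girth C full
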